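{- For every $n>0$, the subposet of $\mathcal{D}_n^A$ formed by its join-irreducible elements is isomorphic to $(T_n^A,\le)$, and the subposet of $\mathcal{D}_n^B$ formed by its join-irreducible elements is isomorphic to $(T_n^B,\le)$, where $T_n^A=\{(i,j)\mid 1\le i<j\le n\}$, $T_n^B=\{(i,j)\mid 1\le i<j\le 2n+1-i\}$ and $(a,b)\le(a',b')$ iff $a\ge a'$ and $b\le b'$.
   Context: $D_n^B$ is the set of words of length $2n$ over $\{u,r\}$ in which every prefix contains at least as many $u$'s as $r$'s; $D_n^A\subseteq D_n^B$ consists of those with exactly $n$ $u$'s. Height sequence of $w\in D_n^B$: let $\rho$ be the number of $r$'s. If $w$ ends with $r$, $k=\rho$ and $h_i$ is the number of $u$'s preceding the $i$-th $r$; if $w$ ends with $u$, $k=\rho+1$, $h_i$ ($i\le\rho$) as before and $h_k$ is the total number of $u$'s. Dominance order $\le_D$: $(h_1,\dots,h_k)\le_D(h'_1,\dots,h'_{k'})$ iff $k\ge k'$ and $h_i\le h'_i$ for $i\in[k']$ (on $D_n^A$, where $k=n$, componentwise comparison). $\mathcal{D}_n^A=(D_n^A,\le_D)$, $\mathcal{D}_n^B=(D_n^B,\le_D)$ are lattices. An element $p$ of a finite lattice is join-irreducible if whenever $p=\bigvee X$ for a subset $X$ we have $p\in X$ (equivalently, $p$ has exactly one lower cover). -}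

module Defs where

open import Data.Nat using (ℕ; zero; suc; _+_; _*_; _≤_; _<_)
open import Data.List using (List; []; _∷_; _++_; length; take)
open import Data.List.Relation.Unary.All using (All)
open import Data.List.Membership.Propositional using (_∈_)
open import Data.Product using (_×_; _,_)
open import Relation.Binary.PropositionalEquality using (_≡_)
open import Function.Bundles using (_⇔_)

data Letter : Set where
  u r : Letter

Word : Set
Word = List Letter

#u : Word → ℕ
#u []       = 0
#u (u ∷ w)  = suc (#u w)
#u (r ∷ w)  = #u w

#r : Word → ℕ
#r []       = 0
#r (u ∷ w)  = #r w
#r (r ∷ w)  = suc (#r w)

InDB : ℕ → Word → Set
InDB n w = (length w ≡ 2 * n) × (∀ k → #r (take k w) ≤ #u (take k w))

InDA : ℕ → Word → Set
InDA n w = InDB n w × (#u w ≡ n)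

-- h_i for the r's: c counts the u's read so far
rHeights : ℕ → Word → List ℕ
rHeights c []      = []
rHeights c (u ∷ w) = rHeights (suc c) w
rHeights c (r ∷ w) = c ∷ rHeights c w

-- extra last entry t (the total number of u's) if the word ends with u
lastEntry : ℕ → Word → List ℕ
lastEntry t []            = []
lastEntry t (u ∷ [])      = t ∷ []
lastEntry t (r ∷ [])      = []
lastEntry t (_ ∷ b ∷ w)   = lastEntry t (b ∷ w)

height : Word → List ℕ
height w = rHeights 0 w ++ lastEntry (#u w) w

-- dominance order on sequences:
-- (h_1..h_k) ≤D (h'_1..h'_k')  iff  k ≥ k' and h_i ≤ h'_i for i ∈ [k']
data _≤D_ : List ℕ → List ℕ → Set where
  nil  : ∀ {h} → h ≤D []
  cons : ∀ {a b h h'} → a ≤ b → h ≤D h' → (a ∷ h) ≤D (b ∷ h')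

_≤W_ : Word → Word → Set
w ≤W w' = height w ≤D height w'

IsJoinIn : {A : Set} → (A → Set) → (A → A → Set) → List A → A → Set
IsJoinIn S _≤_ X p =
  (All (λ x → x ≤ p) X) × (∀ q → S q → All (λ x → x ≤ q) X → p ≤ q)

JoinIrreducibleIn : {A : Set} → (A → Set) → (A → A → Set) → A → Set
JoinIrreducibleIn {A} S _≤_ p =
  S p × (∀ (X : List A) → All S X → IsJoinIn S _≤_ X p → p ∈ X)

InTA : ℕ → ℕ × ℕ → Set
InTA n (i , j) = (1 ≤ i) × (i < j) × (j ≤ n)

-- T_n^B = {(i,j) | 1 ≤ i < j ≤ 2n+1-i}   (j ≤ 2n+1-i written as i + j ≤ 2n+1)
InTB : ℕ → ℕ × ℕ → Set
InTB n (i , j) = (1 ≤ i) × (i < j) × (i + j ≤ 2 * n + 1)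

_≤T_ : ℕ × ℕ → ℕ × ℕ → Set
(a , b) ≤T (a' , b') = (a' ≤ a) × (b ≤ b')

record SubposetIso {A B : Set} (P : A → Set) (_≤₁_ : A → A → Set)
                   (Q : B → Set) (_≤₂_ : B → B → Set) : Set₁ where
  field
    to       : (a : A) → P a → B
    to-Q     : (a : A) (p : P a) → Q (to a p)
    from     : (b : B) → Q b → A
    from-P   : (b : B) (q : Q b) → P (from b q)
    from-to  : (a : A) (p : P a) → from (to a p) (to-Q a p) ≡ a
    to-from  : (b : B) (q : Q b) → to (from b q) (from-P b q) ≡ b
    order    : (a a' : A) (p : P a) (p' : P a') → (a ≤₁ a') ⇔ (to a p ≤₂ to a' p')

-- Identify a word with its height sequence h and say that h passes the test t = (a, b) when
-- h_a ≥ b (vacuously when h has fewer than a entries). On D_n^B the dominance order is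
-- detected by the tests of T_n^B: w ≤ w' iff every test passed by w is passed by w'. The
-- same holds on D_n^A with T_n^A, since the other tests are failed by every word there.
-- Every test t has a least word passing it and a greatest word failing it, both given
-- explicitly. The least passing words are then exactly the join-irreducibles: a join of
-- words all failing t lies below the greatest word failing t, so it fails t as well; and
-- every word is the join of the least words of the tests it passes. Since t passes the least
-- word of s exactly when t ≤ s, the map t ↦ least t is an order isomorphism.

module Submission where

open import Defs
open import Data.Empty using (⊥; ⊥-elim)
open import Data.Unit using (⊤; tt)
open import Data.Nat using (ℕ; zero; suc; _+_; _*_; _∸_; _≤_; _<_; z≤n; s≤s; pred; _≤?_; _<?_)
open import Data.Nat.Properties
open import Data.Nat.Tactic.RingSolver using (solve-∀)
open import Data.Product using (_×_; _,_; proj₁; proj₂; Σ-syntax)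
open import Data.Sum using (_⊎_; inj₁; inj₂)
open import Data.List using (List; []; _∷_; _++_; length; take; replicate; map; filter; upTo; cartesianProduct)
open import Data.List.Properties using (length-++; length-replicate; ++-identityʳ; ++-assoc; ∷-injectiveʳ)
open import Data.List.Relation.Unary.All as All using (All; []; _∷_)
open import Data.List.Relation.Unary.All.Properties using (¬Any⇒All¬)
open import Data.List.Relation.Unary.Any using (any?)
open import Data.List.Relation.Unary.Any.Properties using (applyUpTo⁺)
open import Data.List.Membership.Propositional using (_∈_; find)
open import Data.List.Membership.Propositional.Properties
  using (∈-map⁺; ∈-map⁻; ∈-filter⁺; ∈-filter⁻; ∈-cartesianProduct⁺)
open import Function.Base using (id)
open import Function.Bundles using (_⇔_; mk⇔)
open import Relation.Nullary using (¬_; Dec; yes; no)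
open import Relation.Nullary.Decidable using (_×-dec_; _→-dec_)
open import Relation.Binary.PropositionalEquality
  using (_≡_; _≢_; refl; sym; trans; cong; cong₂; subst; subst₂; module ≡-Reasoning)

-- Join-irreducibles of a lattice whose order is detected by tests

module JoinIrreduciblesByTests
  {A B : Set} (S : A → Set) (_⊑_ : A → A → Set) (T : B → Set) (_≼_ : B → B → Set)
  (Passes : B → A → Set)
  (≼-antisym : ∀ {s t} → s ≼ t → t ≼ s → s ≡ t)
  (⊑-antisym : ∀ {w w'} → S w → S w' → w ⊑ w' → w' ⊑ w → w ≡ w')
  (⊑-byTests : ∀ {w w'} → S w → S w' → (∀ t → T t → Passes t w → Passes t w') → w ⊑ w')
  (Passes-mono : ∀ t {w w'} → w ⊑ w' → Passes t w → Passes t w')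
  (Passes-antitone : ∀ {s t w} → S w → s ≼ t → Passes t w → Passes s w)
  (T? : ∀ t → Dec (T t))
  (Passes? : ∀ t w → Dec (Passes t w))
  (tests : List B) (tests-complete : ∀ {t} → T t → t ∈ tests)
  (least : B → A)
  (least-S : ∀ {t} → T t → S (least t))
  (least-passes : ∀ {t} → T t → Passes t (least t))
  (least-passes⁻ : ∀ {s t} → T s → T t → Passes s (least t) → s ≼ t)
  (failing : B → A)
  (failing-S : ∀ {t} → T t → S (failing t))
  (failing-fails : ∀ {t} → T t → ¬ Passes t (failing t))
  (failing-greatest : ∀ {t w} → T t → S w → ¬ Passes t w → w ⊑ failing t)
  where

  JoinIrreducible : A → Set
  JoinIrreducible = JoinIrreducibleIn S _⊑_

  least⊑ : ∀ {t w} → T t → S w → Passes t w → least t ⊑ w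
  least⊑ Tt Sw passes = ⊑-byTests (least-S Tt) Sw λ s Ts passes-s →
    Passes-antitone Sw (least-passes⁻ Ts Tt passes-s) passes

  least⊑⇒passes : ∀ {t w} → T t → least t ⊑ w → Passes t w
  least⊑⇒passes {t} Tt le = Passes-mono t le (least-passes Tt)

  least-injective : ∀ {s t} → T s → T t → least s ≡ least t → s ≡ t
  least-injective {s} {t} Ts Tt eq =
    ≼-antisym (least-passes⁻ Ts Tt (subst (Passes s) eq (least-passes Ts)))
              (least-passes⁻ Tt Ts (subst (Passes t) (sym eq) (least-passes Tt)))

  -- If some x ∈ X passes t then x = least t; otherwise X lies below failing t, and so does its join.
  least-joinIrreducible : ∀ {t} → T t → JoinIrreducible (least t)
  least-joinIrreducible {t} Tt = least-S Tt , λ X SX (upper , lub) → member X SX upper lub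
    where
    member : ∀ X → All S X → All (_⊑ least t) X → (∀ q → S q → All (_⊑ q) X → least t ⊑ q)
           → least t ∈ X
    member X SX upper lub with any? (Passes? t) X
    ... | yes some = let x , x∈X , passes = find some in
      subst (_∈ X) (⊑-antisym (All.lookup SX x∈X) (least-S Tt) (All.lookup upper x∈X)
                              (least⊑ Tt (All.lookup SX x∈X) passes))
            x∈X
    ... | no none = ⊥-elim (failing-fails Tt (least⊑⇒passes Tt (lub (failing t) (failing-S Tt)
      (All.zipWith (λ (Sx , fails) → failing-greatest Tt Sx fails) (SX , ¬Any⇒All¬ X none)))))

  module _ {p : A} (Sp : S p) where

    PassedBy? : ∀ t → Dec (T t × Passes t p)
    PassedBy? t = T? t ×-dec Passes? t p

    passedLeasts : List A
    passedLeasts = map least (filter PassedBy? tests)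

    passedLeast : ∀ {x} → x ∈ passedLeasts → Σ[ t ∈ B ] T t × Passes t p × x ≡ least t
    passedLeast x∈ with ∈-map⁻ least x∈
    ... | t , t∈ , refl with proj₂ (∈-filter⁻ PassedBy? {xs = tests} t∈)
    ...   | Tt , passes = t , Tt , passes , refl

    passedLeasts-S : All S passedLeasts
    passedLeasts-S = All.tabulate λ x∈ → let _ , Tt , _ , eq = passedLeast x∈ in
      subst S (sym eq) (least-S Tt)

    passedLeasts-join : IsJoinIn S _⊑_ passedLeasts p
    passedLeasts-join = upper , lub
      where
      upper : All (_⊑ p) passedLeasts
      upper = All.tabulate λ x∈ → let _ , Tt , passes , eq = passedLeast x∈ in
        subst (_⊑ p) (sym eq) (least⊑ Tt Sp passes)
      lub : ∀ q → S q → All (_⊑ q) passedLeasts → p ⊑ q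
      lub q Sq below = ⊑-byTests Sp Sq λ t Tt passes → least⊑⇒passes Tt
        (All.lookup below (∈-map⁺ least (∈-filter⁺ PassedBy? (tests-complete Tt) (Tt , passes))))

  joinIrreducible⇒least : ∀ {p} → JoinIrreducible p → Σ[ t ∈ B ] T t × p ≡ least t
  joinIrreducible⇒least (Sp , irreducible) =
    let t , Tt , _ , eq = passedLeast Sp (irreducible _ (passedLeasts-S Sp) (passedLeasts-join Sp))
    in t , Tt , eq

  least⊑least⇔ : ∀ {s t} → T s → T t → (least s ⊑ least t) ⇔ (s ≼ t)
  least⊑least⇔ Ts Tt = mk⇔ (λ le → least-passes⁻ Ts Tt (least⊑⇒passes Ts le))
                          (λ le → least⊑ Ts (least-S Tt) (Passes-antitone (least-S Tt) le (least-passes Tt)))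

  joinIrreducibles≅tests : SubposetIso JoinIrreducible _⊑_ T _≼_
  joinIrreducibles≅tests = record
    { to      = λ p jp → proj₁ (joinIrreducible⇒least jp)
    ; to-Q    = λ p jp → proj₁ (proj₂ (joinIrreducible⇒least jp))
    ; from    = λ t _ → least t
    ; from-P  = λ t Tt → least-joinIrreducible Tt
    ; from-to = λ p jp → sym (proj₂ (proj₂ (joinIrreducible⇒least jp)))
    ; to-from = λ t Tt → let s , Ts , eq = joinIrreducible⇒least (least-joinIrreducible Tt)
                         in least-injective Ts Tt (sym eq)
    ; order   = order
    }
    where
    order : ∀ p p' (jp : JoinIrreducible p) (jp' : JoinIrreducible p')
          → (p ⊑ p') ⇔ (proj₁ (joinIrreducible⇒least jp) ≼ proj₁ (joinIrreducible⇒least jp'))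
    order p p' jp jp' =
      let s , Ts , p≡ = joinIrreducible⇒least jp ; t , Tt , p'≡ = joinIrreducible⇒least jp'
      in subst (λ q → (q ⊑ p') ⇔ (s ≼ t)) (sym p≡)
           (subst (λ q → (least s ⊑ q) ⇔ (s ≼ t)) (sym p'≡) (least⊑least⇔ Ts Tt))

-- Height sequences

-- Entries of a list of naturals, indexed from 0; out of range the entry is 0.
entry : List ℕ → ℕ → ℕ
entry []      _       = 0
entry (x ∷ h) zero    = x
entry (x ∷ h) (suc i) = entry h i

-- h passes the test (i + 1, b) when its (i + 1)-st entry is at least b; an absent entry passes.
EntryGe : ℕ → ℕ → List ℕ → Set
EntryGe i b h = i < length h → b ≤ entry h i

≤D⇒entry≤ : ∀ {h h'} → h ≤D h' → ∀ i → i < length h' → i < length h × entry h i ≤ entry h' i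
≤D⇒entry≤ (cons a≤b _)  zero    _         = s≤s z≤n , a≤b
≤D⇒entry≤ (cons _ h≤h') (suc i) (s≤s i<k) = let i<k' , le = ≤D⇒entry≤ h≤h' i i<k in s≤s i<k' , le

entry≤⇒≤D : ∀ h h' → length h' ≤ length h → (∀ i → i < length h' → entry h i ≤ entry h' i)
          → h ≤D h'
entry≤⇒≤D h       []       _         _  = nil
entry≤⇒≤D (x ∷ h) (y ∷ h') (s≤s k≤k) le =
  cons (le 0 (s≤s z≤n)) (entry≤⇒≤D h h' k≤k (λ i i<k → le (suc i) (s≤s i<k)))

≤D-antisym : ∀ {h h'} → h ≤D h' → h' ≤D h → h ≡ h'
≤D-antisym nil            nil              = refl
≤D-antisym (cons a≤b h≤h') (cons b≤a h'≤h) = cong₂ _∷_ (≤-antisym a≤b b≤a) (≤D-antisym h≤h' h'≤h)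

EntryGe-mono : ∀ {h h'} → h ≤D h' → ∀ i b → EntryGe i b h → EntryGe i b h'
EntryGe-mono h≤h' i b ge i<k' = let i<k , le = ≤D⇒entry≤ h≤h' i i<k' in ≤-trans (ge i<k) le

entry-++ˡ : ∀ xs ys i → i < length xs → entry (xs ++ ys) i ≡ entry xs i
entry-++ˡ (x ∷ xs) ys zero    _         = refl
entry-++ˡ (x ∷ xs) ys (suc i) (s≤s i<k) = entry-++ˡ xs ys i i<k

entry-++ʳ : ∀ xs ys j → entry (xs ++ ys) (length xs + j) ≡ entry ys j
entry-++ʳ []       ys j = refl
entry-++ʳ (x ∷ xs) ys j = entry-++ʳ xs ys j

All⇒entry : ∀ {P : ℕ → Set} h i → All P h → i < length h → P (entry h i)
All⇒entry (x ∷ h) zero    (px ∷ _)  _         = px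
All⇒entry (x ∷ h) (suc i) (_ ∷ ph) (s≤s i<k) = All⇒entry h i ph i<k

length-∷ʳ : ∀ (xs : List ℕ) x → length (xs ++ x ∷ []) ≡ suc (length xs)
length-∷ʳ []       x = refl
length-∷ʳ (y ∷ xs) x = cong suc (length-∷ʳ xs x)

SortedFrom : ℕ → List ℕ → Set
SortedFrom c []      = ⊤
SortedFrom c (x ∷ h) = c ≤ x × SortedFrom x h

SortedFrom-weaken : ∀ {c d} h → c ≤ d → SortedFrom d h → SortedFrom c h
SortedFrom-weaken []      _   _              = tt
SortedFrom-weaken (x ∷ h) c≤d (d≤x , sorted) = ≤-trans c≤d d≤x , sorted

SortedFrom-lowerBound : ∀ {c} h i → SortedFrom c h → i < length h → c ≤ entry h i
SortedFrom-lowerBound (x ∷ h) zero    (c≤x , _)      _         = c≤x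
SortedFrom-lowerBound (x ∷ h) (suc i) (c≤x , sorted) (s≤s i<k) = ≤-trans c≤x (SortedFrom-lowerBound h i sorted i<k)

SortedFrom⇒entry-mono : ∀ {c} h i j → SortedFrom c h → i ≤ j → j < length h → entry h i ≤ entry h j
SortedFrom⇒entry-mono (x ∷ h) zero    zero    _             _         _         = ≤-refl
SortedFrom⇒entry-mono (x ∷ h) zero    (suc j) (_ , sorted)  _         (s≤s j<k) = SortedFrom-lowerBound h j sorted j<k
SortedFrom⇒entry-mono (x ∷ h) (suc i) (suc j) (_ , sorted) (s≤s i≤j) (s≤s j<k) =
  SortedFrom⇒entry-mono h i j sorted i≤j j<k

SortedFrom-∷ʳ : ∀ {c} xs x → SortedFrom c xs → c ≤ x → All (_≤ x) xs → SortedFrom c (xs ++ x ∷ [])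
SortedFrom-∷ʳ []       x _              c≤x _            = c≤x , tt
SortedFrom-∷ʳ (y ∷ xs) x (c≤y , sorted) c≤x (y≤x ∷ xs≤x) = c≤y , SortedFrom-∷ʳ xs x sorted y≤x xs≤x

ExceedsIndexFrom : ℕ → List ℕ → Set
ExceedsIndexFrom c []      = ⊤
ExceedsIndexFrom c (x ∷ h) = suc c ≤ x × ExceedsIndexFrom (suc c) h

ExceedsIndexFrom⇒entry : ∀ {c} h i → ExceedsIndexFrom c h → i < length h → suc (c + i) ≤ entry h i
ExceedsIndexFrom⇒entry {c} (x ∷ h) zero    (c<x , _) _ rewrite +-identityʳ c = c<x
ExceedsIndexFrom⇒entry {c} (x ∷ h) (suc i) (_ , exceeds) (s≤s i<k) rewrite +-suc c i =
  ExceedsIndexFrom⇒entry h i exceeds i<k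

ExceedsIndexFrom-∷ʳ : ∀ {c} xs x → ExceedsIndexFrom c xs → suc (c + length xs) ≤ x
                    → ExceedsIndexFrom c (xs ++ x ∷ [])
ExceedsIndexFrom-∷ʳ {c} []       x _ c<x rewrite +-identityʳ c = c<x , tt
ExceedsIndexFrom-∷ʳ {c} (y ∷ xs) x (c<y , exceeds) lt rewrite +-suc c (length xs) =
  c<y , ExceedsIndexFrom-∷ʳ xs x exceeds lt

LastIs : ℕ → List ℕ → Set
LastIs U []          = ⊥
LastIs U (x ∷ [])    = x ≡ U
LastIs U (x ∷ y ∷ h) = LastIs U (y ∷ h)

LastIs⇒entry-last : ∀ {U} h → LastIs U h → entry h (pred (length h)) ≡ U
LastIs⇒entry-last (x ∷ [])    x≡U  = x≡U
LastIs⇒entry-last (x ∷ y ∷ h) last = LastIs⇒entry-last (y ∷ h) last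

LastIs-∷ : ∀ {U} x h → LastIs U h → LastIs U (x ∷ h)
LastIs-∷ x (y ∷ h) last = last

Ballot : ℕ → ℕ → Word → Set
Ballot cu cr []      = ⊤
Ballot cu cr (u ∷ w) = Ballot (suc cu) cr w
Ballot cu cr (r ∷ w) = suc cr ≤ cu × Ballot cu (suc cr) w

prefixes⇒Ballot : ∀ cu cr w → (∀ k → cr + #r (take k w) ≤ cu + #u (take k w)) → Ballot cu cr w
prefixes⇒Ballot cu cr []      _        = tt
prefixes⇒Ballot cu cr (u ∷ w) prefixes = prefixes⇒Ballot (suc cu) cr w λ k →
  subst (cr + #r (take k w) ≤_) (+-suc cu (#u (take k w))) (prefixes (suc k))
prefixes⇒Ballot cu cr (r ∷ w) prefixes =
  subst (_≤ cu) (+-comm cr 1) (subst (cr + 1 ≤_) (+-identityʳ cu) (prefixes 1)) ,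
  prefixes⇒Ballot cu (suc cr) w λ k →
    subst (_≤ cu + #u (take k w)) (+-suc cr (#r (take k w))) (prefixes (suc k))

Ballot⇒prefixes : ∀ cu cr w → Ballot cu cr w → cr ≤ cu → ∀ k → cr + #r (take k w) ≤ cu + #u (take k w)
Ballot⇒prefixes cu cr w       _ cr≤cu zero = +-monoˡ-≤ 0 cr≤cu
Ballot⇒prefixes cu cr []      _ cr≤cu (suc k) = +-monoˡ-≤ 0 cr≤cu
Ballot⇒prefixes cu cr (u ∷ w) ballot cr≤cu (suc k) =
  subst (cr + #r (take k w) ≤_) (sym (+-suc cu (#u (take k w))))
    (Ballot⇒prefixes (suc cu) cr w ballot (m≤n⇒m≤1+n cr≤cu) k)
Ballot⇒prefixes cu cr (r ∷ w) (cr<cu , ballot) _ (suc k) =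
  subst (_≤ cu + #u (take k w)) (sym (+-suc cr (#r (take k w))))
    (Ballot⇒prefixes cu (suc cr) w ballot cr<cu k)

#u+#r≡length : ∀ w → #u w + #r w ≡ length w
#u+#r≡length []      = refl
#u+#r≡length (u ∷ w) = cong suc (#u+#r≡length w)
#u+#r≡length (r ∷ w) = trans (+-suc (#u w) (#r w)) (cong suc (#u+#r≡length w))

EndsWith : Letter → Word → Set
EndsWith x []          = ⊥
EndsWith x (y ∷ [])    = x ≡ y
EndsWith x (y ∷ z ∷ w) = EndsWith x (z ∷ w)

endsWith-u⊎r : ∀ x w → EndsWith u (x ∷ w) ⊎ EndsWith r (x ∷ w)
endsWith-u⊎r u []      = inj₁ refl
endsWith-u⊎r r []      = inj₂ refl
endsWith-u⊎r x (z ∷ w) = endsWith-u⊎r z w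

endsWith-u⇒1≤#u : ∀ w → EndsWith u w → 1 ≤ #u w
endsWith-u⇒1≤#u (u ∷ [])    _    = s≤s z≤n
endsWith-u⇒1≤#u (u ∷ z ∷ w) _    = s≤s z≤n
endsWith-u⇒1≤#u (r ∷ z ∷ w) ends = endsWith-u⇒1≤#u (z ∷ w) ends

endsWith-r⇒1≤#r : ∀ w → EndsWith r w → 1 ≤ #r w
endsWith-r⇒1≤#r (r ∷ [])    _    = s≤s z≤n
endsWith-r⇒1≤#r (r ∷ z ∷ w) _    = s≤s z≤n
endsWith-r⇒1≤#r (u ∷ z ∷ w) ends = endsWith-r⇒1≤#r (z ∷ w) ends

Ballot⇒#r<#u : ∀ cu cr w → EndsWith u w → Ballot cu cr w → cr ≤ cu → suc (cr + #r w) ≤ cu + #u w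
Ballot⇒#r<#u cu cr (u ∷ []) _ _ cr≤cu =
  subst₂ _≤_ (sym (cong suc (+-identityʳ cr))) (sym (+-comm cu 1)) (s≤s cr≤cu)
Ballot⇒#r<#u cu cr (u ∷ z ∷ w) ends ballot cr≤cu =
  subst (suc (cr + #r (z ∷ w)) ≤_) (sym (+-suc cu (#u (z ∷ w))))
    (Ballot⇒#r<#u (suc cu) cr (z ∷ w) ends ballot (m≤n⇒m≤1+n cr≤cu))
Ballot⇒#r<#u cu cr (r ∷ z ∷ w) ends (cr<cu , ballot) _ =
  subst (λ y → suc y ≤ cu + #u (z ∷ w)) (sym (+-suc cr (#r (z ∷ w))))
    (Ballot⇒#r<#u cu (suc cr) (z ∷ w) ends ballot cr<cu)

lastEntry-endsWith-u : ∀ t w → EndsWith u w → lastEntry t w ≡ t ∷ []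
lastEntry-endsWith-u t (u ∷ [])    _    = refl
lastEntry-endsWith-u t (u ∷ z ∷ w) ends = lastEntry-endsWith-u t (z ∷ w) ends
lastEntry-endsWith-u t (r ∷ z ∷ w) ends = lastEntry-endsWith-u t (z ∷ w) ends

lastEntry-endsWith-r : ∀ t w → EndsWith r w → lastEntry t w ≡ []
lastEntry-endsWith-r t (r ∷ [])    _    = refl
lastEntry-endsWith-r t (u ∷ z ∷ w) ends = lastEntry-endsWith-r t (z ∷ w) ends
lastEntry-endsWith-r t (r ∷ z ∷ w) ends = lastEntry-endsWith-r t (z ∷ w) ends

length-rHeights : ∀ c w → length (rHeights c w) ≡ #r w
length-rHeights c []      = refl
length-rHeights c (u ∷ w) = length-rHeights (suc c) w
length-rHeights c (r ∷ w) = cong suc (length-rHeights c w)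

rHeights-sorted : ∀ c w → SortedFrom c (rHeights c w)
rHeights-sorted c []      = tt
rHeights-sorted c (u ∷ w) = SortedFrom-weaken (rHeights (suc c) w) (n≤1+n c) (rHeights-sorted (suc c) w)
rHeights-sorted c (r ∷ w) = ≤-refl , rHeights-sorted c w

rHeights-exceedIndex : ∀ cu cr w → Ballot cu cr w → ExceedsIndexFrom cr (rHeights cu w)
rHeights-exceedIndex cu cr []      _                = tt
rHeights-exceedIndex cu cr (u ∷ w) ballot           = rHeights-exceedIndex (suc cu) cr w ballot
rHeights-exceedIndex cu cr (r ∷ w) (cr<cu , ballot) = cr<cu , rHeights-exceedIndex cu (suc cr) w ballot

rHeights-≤ : ∀ cu w → All (_≤ cu + #u w) (rHeights cu w)
rHeights-≤ cu []      = []
rHeights-≤ cu (u ∷ w) =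
  subst (λ y → All (_≤ y) (rHeights (suc cu) w)) (sym (+-suc cu (#u w))) (rHeights-≤ (suc cu) w)
rHeights-≤ cu (r ∷ w) = m≤m+n cu (#u w) ∷ rHeights-≤ cu w

rHeights-< : ∀ cu w → EndsWith u w → All (_< cu + #u w) (rHeights cu w)
rHeights-< cu (u ∷ [])    _    = []
rHeights-< cu (u ∷ z ∷ w) ends =
  subst (λ y → All (_< y) (rHeights (suc cu) (z ∷ w))) (sym (+-suc cu (#u (z ∷ w))))
    (rHeights-< (suc cu) (z ∷ w) ends)
rHeights-< cu (r ∷ z ∷ w) ends =
  subst (_≤ cu + #u (z ∷ w)) (+-comm cu 1) (+-monoʳ-≤ cu (endsWith-u⇒1≤#u (z ∷ w) ends))
  ∷ rHeights-< cu (z ∷ w) ends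

rHeights-last : ∀ cu w → EndsWith r w → LastIs (cu + #u w) (rHeights cu w)
rHeights-last cu (r ∷ [])    _    = sym (+-identityʳ cu)
rHeights-last cu (u ∷ z ∷ w) ends =
  subst (λ y → LastIs y (rHeights (suc cu) (z ∷ w))) (sym (+-suc cu (#u (z ∷ w))))
    (rHeights-last (suc cu) (z ∷ w) ends)
rHeights-last cu (r ∷ z ∷ w) ends = LastIs-∷ cu (rHeights cu (z ∷ w)) (rHeights-last cu (z ∷ w) ends)

-- Shape of the height sequence h of a word with U u's and R r's: it has R entries if the
-- word ends with r, and R + 1 entries (the last being U, above all others) if it ends with u.
record HeightShape (n U : ℕ) (h : List ℕ) : Set where
  field
    R           : ℕ
    U+R≡n+n     : U + R ≡ n + n
    sorted      : ∀ i j → i ≤ j → j < length h → entry h i ≤ entry h j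
    index<entry : ∀ i → i < length h → suc i ≤ entry h i
    entry≤U     : ∀ i → i < length h → entry h i ≤ U
    U≤last      : U ≤ entry h (pred (length h))
    shape       : (length h ≡ R × 1 ≤ R)
                ⊎ (length h ≡ suc R × suc R ≤ U × (∀ i → suc i < length h → suc (entry h i) ≤ U))

heightShape-endsWith-r : ∀ n U R hs → length hs ≡ R → 1 ≤ R → SortedFrom 0 hs → ExceedsIndexFrom 0 hs
                       → All (_≤ U) hs → LastIs U hs → U + R ≡ n + n → HeightShape n U hs
heightShape-endsWith-r n U R hs k≡R 1≤R sorted exceeds ≤U last U+R≡n+n = record
  { R           = R
  ; U+R≡n+n     = U+R≡n+n
  ; sorted      = λ i j → SortedFrom⇒entry-mono hs i j sorted
  ; index<entry = λ i → ExceedsIndexFrom⇒entry hs i exceeds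
  ; entry≤U     = λ i → All⇒entry hs i ≤U
  ; U≤last      = ≤-reflexive (sym (LastIs⇒entry-last hs last))
  ; shape       = inj₁ (k≡R , 1≤R)
  }

heightShape-endsWith-u : ∀ n U R hs → length hs ≡ R → SortedFrom 0 hs → ExceedsIndexFrom 0 hs
                       → All (_< U) hs → suc R ≤ U → U + R ≡ n + n → HeightShape n U (hs ++ U ∷ [])
heightShape-endsWith-u n U R hs k≡R sorted exceeds <U R<U U+R≡n+n = record
  { R           = R
  ; U+R≡n+n     = U+R≡n+n
  ; sorted      = λ i j → SortedFrom⇒entry-mono (hs ++ U ∷ []) i j
                            (SortedFrom-∷ʳ hs U sorted z≤n (All.map <⇒≤ <U))
  ; index<entry = λ i → ExceedsIndexFrom⇒entry (hs ++ U ∷ []) i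
                          (ExceedsIndexFrom-∷ʳ hs U exceeds (subst (_< U) (sym k≡R) R<U))
  ; entry≤U     = entry≤U
  ; U≤last      = ≤-reflexive (sym (subst (λ j → entry (hs ++ U ∷ []) j ≡ U) k+0≡pred-k last≡U))
  ; shape       = inj₂ (trans (length-∷ʳ hs U) (cong suc k≡R) , R<U , entry<U)
  }
  where
  last≡U : entry (hs ++ U ∷ []) (length hs + 0) ≡ U
  last≡U = entry-++ʳ hs (U ∷ []) 0
  k+0≡pred-k : length hs + 0 ≡ pred (length (hs ++ U ∷ []))
  k+0≡pred-k = trans (+-identityʳ _) (cong pred (sym (length-∷ʳ hs U)))
  entry<U : ∀ i → suc i < length (hs ++ U ∷ []) → entry (hs ++ U ∷ []) i < U
  entry<U i i<k rewrite length-∷ʳ hs U =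
    subst (_< U) (sym (entry-++ˡ hs (U ∷ []) i (≤-pred i<k))) (All⇒entry hs i <U (≤-pred i<k))
  entry≤U : ∀ i → i < length (hs ++ U ∷ []) → entry (hs ++ U ∷ []) i ≤ U
  entry≤U i i≤k rewrite length-∷ʳ hs U with i <? length hs
  ... | yes i<k = subst (_≤ U) (sym (entry-++ˡ hs (U ∷ []) i i<k)) (<⇒≤ (All⇒entry hs i <U i<k))
  ... | no  i≮k = ≤-reflexive (subst (λ j → entry (hs ++ U ∷ []) j ≡ U) i≡k+0 last≡U)
    where
    i≡k+0 : length hs + 0 ≡ i
    i≡k+0 = trans (+-identityʳ _) (≤-antisym (≮⇒≥ i≮k) (≤-pred i≤k))

2n≡n+n : ∀ n → 2 * n ≡ n + n
2n≡n+n n = cong (n +_) (+-identityʳ n)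

height-shape : ∀ n w → InDB n w → 0 < n → HeightShape n (#u w) (height w)
height-shape n [] (len , _) 0<n = ⊥-elim (<-irrefl (trans len (2n≡n+n n)) (+-mono-≤ 0<n z≤n))
height-shape n w@(x ∷ w') (len , prefixes) _ with endsWith-u⊎r x w'
... | inj₁ ends = subst (HeightShape n U) (sym (cong (hs ++_) (lastEntry-endsWith-u U w ends)))
  (heightShape-endsWith-u n U R hs (length-rHeights 0 w) (rHeights-sorted 0 w) (rHeights-exceedIndex 0 0 w ballot)
    (rHeights-< 0 w ends) (Ballot⇒#r<#u 0 0 w ends ballot z≤n) U+R≡n+n)
  where
  U R : ℕ
  U = #u w
  R = #r w
  hs : List ℕ
  hs = rHeights 0 w
  ballot : Ballot 0 0 w
  ballot = prefixes⇒Ballot 0 0 w prefixes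
  U+R≡n+n : U + R ≡ n + n
  U+R≡n+n = trans (#u+#r≡length w) (trans len (2n≡n+n n))
... | inj₂ ends = subst (HeightShape n U) (sym (trans (cong (hs ++_) (lastEntry-endsWith-r U w ends)) (++-identityʳ hs)))
  (heightShape-endsWith-r n U R hs (length-rHeights 0 w) (endsWith-r⇒1≤#r w ends) (rHeights-sorted 0 w)
    (rHeights-exceedIndex 0 0 w (prefixes⇒Ballot 0 0 w prefixes)) (rHeights-≤ 0 w) (rHeights-last 0 w ends) U+R≡n+n)
  where
  U R : ℕ
  U = #u w
  R = #r w
  hs : List ℕ
  hs = rHeights 0 w
  U+R≡n+n : U + R ≡ n + n
  U+R≡n+n = trans (#u+#r≡length w) (trans len (2n≡n+n n))

-- The height sequence computed in one pass, so that its head reveals the first letter of the word.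
heights : ℕ → Word → List ℕ
heights c []          = []
heights c (u ∷ [])    = suc c ∷ []
heights c (u ∷ x ∷ w) = heights (suc c) (x ∷ w)
heights c (r ∷ [])    = c ∷ []
heights c (r ∷ x ∷ w) = c ∷ heights c (x ∷ w)

rHeights++lastEntry≡heights : ∀ c w → rHeights c w ++ lastEntry (c + #u w) w ≡ heights c w
rHeights++lastEntry≡heights c []          = refl
rHeights++lastEntry≡heights c (u ∷ [])    = cong (_∷ []) (trans (+-suc c 0) (cong suc (+-identityʳ c)))
rHeights++lastEntry≡heights c (u ∷ x ∷ w) =
  trans (cong (λ t → rHeights (suc c) (x ∷ w) ++ lastEntry t (x ∷ w)) (+-suc c (#u (x ∷ w))))
        (rHeights++lastEntry≡heights (suc c) (x ∷ w))
rHeights++lastEntry≡heights c (r ∷ [])    = refl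
rHeights++lastEntry≡heights c (r ∷ x ∷ w) = cong (c ∷_) (rHeights++lastEntry≡heights c (x ∷ w))

head₀ : List ℕ → ℕ
head₀ []      = 0
head₀ (x ∷ _) = x

heights-head≥ : ∀ c x w → c ≤ head₀ (heights c (x ∷ w))
heights-head≥ c u []      = n≤1+n c
heights-head≥ c u (y ∷ w) = ≤-trans (n≤1+n c) (heights-head≥ (suc c) y w)
heights-head≥ c r []      = ≤-refl
heights-head≥ c r (y ∷ w) = ≤-refl

heights-head-u : ∀ c w → suc c ≤ head₀ (heights c (u ∷ w))
heights-head-u c []      = ≤-refl
heights-head-u c (y ∷ w) = heights-head≥ (suc c) y w

heights-head-r : ∀ c w → head₀ (heights c (r ∷ w)) ≡ c
heights-head-r c []      = refl
heights-head-r c (y ∷ w) = refl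

heights-u≢r : ∀ c w w' → heights c (u ∷ w) ≢ heights c (r ∷ w')
heights-u≢r c w w' eq = <-irrefl (sym (trans (cong head₀ eq) (heights-head-r c w'))) (heights-head-u c w)

heights-injective : ∀ c w w' → length w ≡ length w' → heights c w ≡ heights c w' → w ≡ w'
heights-injective c []          []           _   _  = refl
heights-injective c (u ∷ [])    (u ∷ [])     _   _  = refl
heights-injective c (r ∷ [])    (r ∷ [])     _   _  = refl
heights-injective c (u ∷ x ∷ w) (u ∷ y ∷ w') len eq =
  cong (u ∷_) (heights-injective (suc c) (x ∷ w) (y ∷ w') (suc-injective len) eq)
heights-injective c (r ∷ x ∷ w) (r ∷ y ∷ w') len eq =
  cong (r ∷_) (heights-injective c (x ∷ w) (y ∷ w') (suc-injective len) (∷-injectiveʳ eq))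
heights-injective c (u ∷ w)     (r ∷ w')     _   eq = ⊥-elim (heights-u≢r c w w' eq)
heights-injective c (r ∷ w)     (u ∷ w')     _   eq = ⊥-elim (heights-u≢r c w' w (sym eq))
heights-injective c (u ∷ [])    (u ∷ _ ∷ _)  ()  _
heights-injective c (u ∷ _ ∷ _) (u ∷ [])     ()  _
heights-injective c (r ∷ [])    (r ∷ _ ∷ _)  ()  _
heights-injective c (r ∷ _ ∷ _) (r ∷ [])     ()  _

height-injective : ∀ {w w'} → length w ≡ length w' → height w ≡ height w' → w ≡ w'
height-injective {w} {w'} len eq = heights-injective 0 w w' len
  (trans (sym (rHeights++lastEntry≡heights 0 w)) (trans eq (rHeights++lastEntry≡heights 0 w')))

-- The dominance order is detected by the tests of T_n^B

1+n+n≡2n+1 : ∀ n → suc (n + n) ≡ 2 * n + 1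
1+n+n≡2n+1 n = trans (+-comm 1 (n + n)) (cong (_+ 1) (sym (2n≡n+n n)))

inTB : ∀ n {a b} → 1 ≤ a → a < b → a + b ≤ suc (n + n) → InTB n (a , b)
inTB n {a} {b} 1≤a a<b a+b≤ = 1≤a , a<b , subst (a + b ≤_) (1+n+n≡2n+1 n) a+b≤

inTB⇒≤ : ∀ n {a b} → InTB n (a , b) → a + b ≤ suc (n + n)
inTB⇒≤ n {a} {b} (_ , _ , a+b≤) = subst (a + b ≤_) (sym (1+n+n≡2n+1 n)) a+b≤

+-≡-swap-≤ : ∀ a b c d → a + b ≡ c + d → b ≤ d → c ≤ a
+-≡-swap-≤ a b c d eq b≤d with c ≤? a
... | yes c≤a = c≤a
... | no  c≰a = ⊥-elim (<-irrefl eq (+-mono-<-≤ (≰⇒> c≰a) b≤d))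

TestsTransfer : ℕ → List ℕ → List ℕ → Set
TestsTransfer n h h' = ∀ a b → InTB n (a , b) → EntryGe (pred a) b h → EntryGe (pred a) b h'

module _ {n U U' : ℕ} {h h' : List ℕ} (v : HeightShape n U h) (v' : HeightShape n U' h')
         (transfer : TestsTransfer n h h') where

  private
    module V  = HeightShape v
    module V' = HeightShape v'
    N k k' : ℕ
    N  = n + n
    k  = length h
    k' = length h'

    absent⇒EntryGe : ∀ {i} b → ¬ i < k → EntryGe i b h
    absent⇒EntryGe b i≮k i<k = ⊥-elim (i≮k i<k)

    R≤k : V.R ≤ k
    R≤k with V.shape
    ... | inj₁ (k≡R , _) = ≤-reflexive (sym k≡R)
    ... | inj₂ (k≡1+R , _) = subst (V.R ≤_) (sym k≡1+R) (n≤1+n _)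

    k≤1+R : k ≤ suc V.R
    k≤1+R with V.shape
    ... | inj₁ (k≡R , _) = subst (_≤ suc V.R) (sym k≡R) (n≤1+n _)
    ... | inj₂ (k≡1+R , _) = ≤-reflexive k≡1+R

    R'+U'≡N : V'.R + U' ≡ N
    R'+U'≡N = trans (+-comm V'.R U') V'.U+R≡n+n

    -- Test (k + 1, x + 1) with x the (k + 1)-st entry of h': h has no such entry, h' fails.
    fresh-test : k < k' → suc (k + entry h' k) ≤ N → ⊥
    fresh-test k<k' fits = <-irrefl refl (transfer (suc k) (suc x) test (absent⇒EntryGe (suc x) (<-irrefl refl)) k<k')
      where
      x : ℕ
      x = entry h' k
      test : InTB n (suc k , suc x)
      test = inTB n (s≤s z≤n) (s≤s (V'.index<entry k k<k')) (s≤s (subst (_≤ N) (sym (+-suc k x)) fits))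

    -- When h' = (…, U') ends a word with R' r's and a final u, test (R', U') is passed by a
    -- sequence h of length R' (its last entry is at least U ≥ U'), but not by h'.
    final-u-test : k < k' → k ≡ V'.R → suc V'.R ≤ U' → (∀ i → suc i < k' → suc (entry h' i) ≤ U') → ⊥
    final-u-test k<k' k≡R' R'<U' entries<U' = at (pred k) (suc-pred-of 1≤k)
      where
      suc-pred-of : ∀ {m} → 1 ≤ m → suc (pred m) ≡ m
      suc-pred-of (s≤s _) = refl
      1≤k : 1 ≤ k
      1≤k with V.shape
      ... | inj₁ (k≡R , 1≤R) = subst (1 ≤_) (sym k≡R) 1≤R
      ... | inj₂ (k≡1+R , _) = subst (1 ≤_) (sym k≡1+R) (s≤s z≤n)
      U'≤U : U' ≤ U
      U'≤U = +-≡-swap-≤ U V.R U' V'.R (trans V.U+R≡n+n (sym V'.U+R≡n+n)) (subst (V.R ≤_) k≡R' R≤k)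
      at : ∀ j → suc j ≡ k → ⊥
      at j 1+j≡k = <-irrefl refl (≤-trans (s≤s U'≤h'ⱼ) (entries<U' j (subst (_< k') (sym 1+j≡k) k<k')))
        where
        test : InTB n (suc j , U')
        test = inTB n (s≤s z≤n) (subst (_< U') (sym (trans 1+j≡k k≡R')) R'<U')
          (subst (_≤ suc N) (cong (_+ U') (sym (trans 1+j≡k k≡R'))) (≤-trans (≤-reflexive R'+U'≡N) (n≤1+n N)))
        h-passes : EntryGe j U' h
        h-passes _ = ≤-trans U'≤U (subst (λ m → U ≤ entry h (pred m)) (sym 1+j≡k) V.U≤last)
        U'≤h'ⱼ : U' ≤ entry h' j
        U'≤h'ⱼ = transfer (suc j) U' test h-passes (≤-trans (n≤1+n (suc j)) (subst (_< k') (sym 1+j≡k) k<k'))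

    k<k'⇒⊥ : k < k' → ⊥
    k<k'⇒⊥ k<k' with suc (k + entry h' k) ≤? N
    ... | yes fits = fresh-test k<k' fits
    ... | no  N≤k+x with V'.shape
    ...   | inj₁ (k'≡R' , _) = N≤k+x (subst (k + entry h' k <_) R'+U'≡N
                                 (+-mono-<-≤ (subst (k <_) k'≡R' k<k') (V'.entry≤U k k<k')))
    ...   | inj₂ (k'≡1+R' , R'<U' , entries<U') with k <? V'.R
    ...     | yes k<R' = N≤k+x (subst (k + entry h' k <_) R'+U'≡N
                           (+-mono-< k<R' (entries<U' k (subst (suc k <_) (sym k'≡1+R') (s≤s k<R')))))
    ...     | no  k≮R' = final-u-test k<k' (≤-antisym (≤-pred (subst (k <_) k'≡1+R' k<k')) (≮⇒≥ k≮R'))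
                           R'<U' entries<U'

    length-antitone : k' ≤ k
    length-antitone with k' ≤? k
    ... | yes k'≤k = k'≤k
    ... | no  k'≰k = ⊥-elim (k<k'⇒⊥ (≰⇒> k'≰k))

    -- If i + 1 < hᵢ₊₁, test (i + 1, hᵢ₊₁) is passed by h, hence by h'; otherwise hᵢ₊₁ ≤ i + 1 ≤ h'ᵢ₊₁.
    entry-mono : ∀ i → i < k' → entry h i ≤ entry h' i
    entry-mono i i<k' with suc i <? entry h i
    ... | yes i<hᵢ = transfer (suc i) (entry h i) test (λ _ → ≤-refl) i<k'
      where
      i<k : i < k
      i<k = ≤-trans i<k' length-antitone
      test : InTB n (suc i , entry h i)
      test = inTB n (s≤s z≤n) i<hᵢ (≤-trans (+-mono-≤ (≤-trans i<k k≤1+R) (V.entry≤U i i<k))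
                                          (≤-reflexive (cong suc (trans (+-comm V.R U) V.U+R≡n+n))))
    ... | no  i≮hᵢ = ≤-trans (≮⇒≥ i≮hᵢ) (V'.index<entry i i<k')

  tests⇒≤D : h ≤D h'
  tests⇒≤D = entry≤⇒≤D h h' length-antitone entry-mono

-- Least passing and greatest failing words

u^ r^ : ℕ → Word
u^ m = replicate m u
r^ m = replicate m r

ur^ : ℕ → Word
ur^ zero    = []
ur^ (suc m) = u ∷ r ∷ ur^ m

staircase : ℕ → ℕ → List ℕ
staircase c zero    = []
staircase c (suc m) = suc c ∷ staircase (suc c) m

length-staircase : ∀ c m → length (staircase c m) ≡ m
length-staircase c zero    = refl
length-staircase c (suc m) = cong suc (length-staircase (suc c) m)

entry-staircase : ∀ c m i → i < m → entry (staircase c m) i ≡ suc (c + i)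
entry-staircase c (suc m) zero    _         = cong suc (sym (+-identityʳ c))
entry-staircase c (suc m) (suc i) (s≤s i<m) = trans (entry-staircase (suc c) m i i<m) (cong suc (sym (+-suc c i)))

entry-replicate : ∀ m (x : ℕ) i → i < m → entry (replicate m x) i ≡ x
entry-replicate (suc m) x zero    _         = refl
entry-replicate (suc m) x (suc i) (s≤s i<m) = entry-replicate m x i i<m

length-ur^ : ∀ m → length (ur^ m) ≡ m + m
length-ur^ zero    = refl
length-ur^ (suc m) = cong suc (trans (cong suc (length-ur^ m)) (sym (+-suc m m)))

#u-++ : ∀ v w → #u (v ++ w) ≡ #u v + #u w
#u-++ []      w = refl
#u-++ (u ∷ v) w = cong suc (#u-++ v w)
#u-++ (r ∷ v) w = #u-++ v w

#u-u^ : ∀ m → #u (u^ m) ≡ m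
#u-u^ zero    = refl
#u-u^ (suc m) = cong suc (#u-u^ m)

#u-r^ : ∀ m → #u (r^ m) ≡ 0
#u-r^ zero    = refl
#u-r^ (suc m) = #u-r^ m

#u-ur^ : ∀ m → #u (ur^ m) ≡ m
#u-ur^ zero    = refl
#u-ur^ (suc m) = cong suc (#u-ur^ m)

rHeights-u^ : ∀ c m → rHeights c (u^ m) ≡ []
rHeights-u^ c zero    = refl
rHeights-u^ c (suc m) = rHeights-u^ (suc c) m

rHeights-r^ : ∀ c m → rHeights c (r^ m) ≡ replicate m c
rHeights-r^ c zero    = refl
rHeights-r^ c (suc m) = cong (c ∷_) (rHeights-r^ c m)

rHeights-ur^ : ∀ c m → rHeights c (ur^ m) ≡ staircase c m
rHeights-ur^ c zero    = refl
rHeights-ur^ c (suc m) = cong (suc c ∷_) (rHeights-ur^ (suc c) m)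

rHeights-u^-++ : ∀ c m w → rHeights c (u^ m ++ w) ≡ rHeights (m + c) w
rHeights-u^-++ c zero    w = refl
rHeights-u^-++ c (suc m) w = trans (rHeights-u^-++ (suc c) m w) (cong (λ c' → rHeights c' w) (+-suc m c))

rHeights-r^-++ : ∀ c m w → rHeights c (r^ m ++ w) ≡ replicate m c ++ rHeights c w
rHeights-r^-++ c zero    w = refl
rHeights-r^-++ c (suc m) w = cong (c ∷_) (rHeights-r^-++ c m w)

rHeights-ur^-++ : ∀ c m w → rHeights c (ur^ m ++ w) ≡ staircase c m ++ rHeights (m + c) w
rHeights-ur^-++ c zero    w = refl
rHeights-ur^-++ c (suc m) w = cong (suc c ∷_)
  (trans (rHeights-ur^-++ (suc c) m w) (cong (λ c' → staircase (suc c) m ++ rHeights c' w) (+-suc m c)))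

ballot-u^ : ∀ cu cr m → Ballot cu cr (u^ m)
ballot-u^ cu cr zero    = tt
ballot-u^ cu cr (suc m) = ballot-u^ (suc cu) cr m

ballot-r^ : ∀ cu cr m → m + cr ≤ cu → Ballot cu cr (r^ m)
ballot-r^ cu cr zero    _  = tt
ballot-r^ cu cr (suc m) le =
  ≤-trans (s≤s (m≤n+m cr m)) le , ballot-r^ cu (suc cr) m (subst (_≤ cu) (sym (+-suc m cr)) le)

ballot-ur^ : ∀ cu cr m → cr ≤ cu → Ballot cu cr (ur^ m)
ballot-ur^ cu cr zero    _     = tt
ballot-ur^ cu cr (suc m) cr≤cu = s≤s cr≤cu , ballot-ur^ (suc cu) (suc cr) m (s≤s cr≤cu)

ballot-u^-++ : ∀ cu cr m w → Ballot (m + cu) cr w → Ballot cu cr (u^ m ++ w)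
ballot-u^-++ cu cr zero    w ballot = ballot
ballot-u^-++ cu cr (suc m) w ballot = ballot-u^-++ (suc cu) cr m w (subst (λ c → Ballot c cr w) (sym (+-suc m cu)) ballot)

ballot-r^-++ : ∀ cu cr m w → m + cr ≤ cu → Ballot cu (m + cr) w → Ballot cu cr (r^ m ++ w)
ballot-r^-++ cu cr zero    w _  ballot = ballot
ballot-r^-++ cu cr (suc m) w le ballot = ≤-trans (s≤s (m≤n+m cr m)) le ,
  ballot-r^-++ cu (suc cr) m w (subst (_≤ cu) (sym (+-suc m cr)) le)
    (subst (λ c → Ballot cu c w) (sym (+-suc m cr)) ballot)

ballot-ur^-++ : ∀ cu cr m w → cr ≤ cu → Ballot (m + cu) (m + cr) w → Ballot cu cr (ur^ m ++ w)
ballot-ur^-++ cu cr zero    w _     ballot = ballot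
ballot-ur^-++ cu cr (suc m) w cr≤cu ballot = s≤s cr≤cu , ballot-ur^-++ (suc cu) (suc cr) m w (s≤s cr≤cu)
  (subst₂ (λ c c' → Ballot c c' w) (sym (+-suc m cu)) (sym (+-suc m cr)) ballot)

ballot⇒InDB : ∀ n w → length w ≡ 2 * n → Ballot 0 0 w → InDB n w
ballot⇒InDB n w len ballot = len , Ballot⇒prefixes 0 0 w ballot z≤n

endsWith-++ : ∀ x v y w → EndsWith x (y ∷ w) → EndsWith x (v ++ y ∷ w)
endsWith-++ x []           y w ends = ends
endsWith-++ x (z ∷ [])     y w ends = ends
endsWith-++ x (z ∷ z' ∷ v) y w ends = endsWith-++ x (z' ∷ v) y w ends

endsWith-++ʳ : ∀ x v w → EndsWith x w → EndsWith x (v ++ w)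
endsWith-++ʳ x v (y ∷ w) ends = endsWith-++ x v y w ends

endsWith-replicate : ∀ x m → EndsWith x (replicate (suc m) x)
endsWith-replicate x zero    = refl
endsWith-replicate x (suc m) = endsWith-replicate x m

endsWith-ur^ : ∀ m → EndsWith r (ur^ (suc m))
endsWith-ur^ zero    = refl
endsWith-ur^ (suc m) = endsWith-ur^ m

Passes : ℕ × ℕ → Word → Set
Passes (a , b) w = EntryGe (pred a) b (height w)

Passes? : ∀ t w → Dec (Passes t w)
Passes? (a , b) w = (pred a <? length (height w)) →-dec (b ≤? entry (height w) (pred a))

¬EntryGe : ∀ i b h → ¬ EntryGe i b h → i < length h × entry h i < b
¬EntryGe i b h fails with i <? length h
... | no  i≮k = ⊥-elim (fails (λ i<k → ⊥-elim (i≮k i<k)))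
... | yes i<k with b ≤? entry h i
...   | yes b≤hᵢ = ⊥-elim (fails (λ _ → b≤hᵢ))
...   | no  b≰hᵢ = i<k , ≰⇒> b≰hᵢ

EntryGe-++ʳ⁻ : ∀ xs ys j b → EntryGe (length xs + j) b (xs ++ ys) → EntryGe j b ys
EntryGe-++ʳ⁻ xs ys j b ge j<k = subst (b ≤_) (entry-++ʳ xs ys j)
  (ge (subst (length xs + j <_) (sym (length-++ xs)) (+-monoʳ-< (length xs) j<k)))

EntryGe-++ʳ⁺ : ∀ xs ys j b → EntryGe j b ys → EntryGe (length xs + j) b (xs ++ ys)
EntryGe-++ʳ⁺ xs ys j b ge i<k = subst (b ≤_) (sym (entry-++ʳ xs ys j))
  (ge (+-cancelˡ-≤ (length xs) _ _ (subst (length xs + suc j ≤_) (length-++ xs)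
        (subst (_≤ length (xs ++ ys)) (sym (+-suc (length xs) j)) i<k))))

EntryGe-++ˡ⁺ : ∀ xs ys i b → i < length xs → b ≤ entry xs i → EntryGe i b (xs ++ ys)
EntryGe-++ˡ⁺ xs ys i b i<k b≤xᵢ _ = subst (b ≤_) (sym (entry-++ˡ xs ys i i<k)) b≤xᵢ

EntryGe-++ˡ⁻ : ∀ xs ys i b → i < length xs → EntryGe i b (xs ++ ys) → b ≤ entry xs i
EntryGe-++ˡ⁻ xs ys i b i<k ge = subst (b ≤_) (entry-++ˡ xs ys i i<k)
  (ge (subst (i <_) (sym (length-++ xs)) (≤-trans i<k (m≤m+n _ _))))

EntryGe-replicate-++⁻ : ∀ m x rest j b → j < m → EntryGe j b (replicate m x ++ rest) → b ≤ x
EntryGe-replicate-++⁻ m x rest j b j<m ge = subst (b ≤_) (entry-replicate m x j j<m)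
  (EntryGe-++ˡ⁻ (replicate m x) rest j b (subst (j <_) (sym (length-replicate m)) j<m) ge)

EntryGe-staircase-++ : ∀ x rest b → EntryGe 0 b rest → EntryGe x b (staircase 0 x ++ rest)
EntryGe-staircase-++ x rest b ge = subst (λ i → EntryGe i b (staircase 0 x ++ rest))
  (trans (+-identityʳ _) (length-staircase 0 x)) (EntryGe-++ʳ⁺ (staircase 0 x) rest 0 b ge)

EntryGe-staircase-++⁻ : ∀ M x rest b
  → (∀ j b' → suc (x + j) < b' → suc (x + j) + b' ≤ M → EntryGe j b' rest → b' ≤ b)
  → ∀ a' b' → 1 ≤ a' → a' < b' → a' + b' ≤ M → EntryGe (pred a') b' (staircase 0 x ++ rest)
  → suc x ≤ a' × b' ≤ b
EntryGe-staircase-++⁻ M x rest b rest-bound (suc i) b' _ a'<b' fits ge with suc x ≤? suc i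
... | no  x≮i+1 = ⊥-elim (<-irrefl refl (≤-trans a'<b' (subst (b' ≤_) (entry-staircase 0 x i i<x)
        (EntryGe-++ˡ⁻ (staircase 0 x) rest i b' (subst (i <_) (sym (length-staircase 0 x)) i<x) ge))))
  where
  i<x : i < x
  i<x = ≤-pred (≰⇒> x≮i+1)
... | yes x<i+1 with m≤n⇒∃[o]m+o≡n (≤-pred x<i+1)
...   | j , refl = x<i+1 , rest-bound j b' a'<b' fits
        (EntryGe-++ʳ⁻ (staircase 0 x) rest j b'
          (subst (λ l → EntryGe (l + j) b' (staircase 0 x ++ rest)) (sym (length-staircase 0 x)) ge))

-- The least word passing test (x + 1, x + p + 1), when x + p + 1 + q = n: heights
-- 1, …, x, then p + 1 copies of x + p + 1, then x + p + 2, …, n.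
leastWordLow : ℕ → ℕ → ℕ → Word
leastWordLow x p q = ur^ x ++ u^ (suc p) ++ r^ (suc p) ++ ur^ q

length-leastWordLow : ∀ x p q → length (leastWordLow x p q) ≡ 2 * (suc (x + p) + q)
length-leastWordLow x p q = begin
  length (leastWordLow x p q)
    ≡⟨ length-++ (ur^ x) ⟩
  length (ur^ x) + length (u^ (suc p) ++ r^ (suc p) ++ ur^ q)
    ≡⟨ cong₂ _+_ (length-ur^ x) (trans (length-++ (u^ (suc p))) (cong₂ _+_ (length-replicate (suc p))
         (trans (length-++ (r^ (suc p))) (cong₂ _+_ (length-replicate (suc p)) (length-ur^ q))))) ⟩
  x + x + (suc p + (suc p + (q + q)))
    ≡⟨ normalise x p q ⟩
  2 * (suc (x + p) + q) ∎
  where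
  open ≡-Reasoning
  normalise : ∀ x p q → x + x + (suc p + (suc p + (q + q))) ≡ 2 * (suc (x + p) + q)
  normalise = solve-∀

#u-leastWordLow : ∀ x p q → #u (leastWordLow x p q) ≡ suc (x + p) + q
#u-leastWordLow x p q = begin
  #u (leastWordLow x p q)
    ≡⟨ #u-++ (ur^ x) _ ⟩
  #u (ur^ x) + #u (u^ (suc p) ++ r^ (suc p) ++ ur^ q)
    ≡⟨ cong₂ _+_ (#u-ur^ x) (trans (#u-++ (u^ (suc p)) _) (cong₂ _+_ (#u-u^ (suc p))
         (trans (#u-++ (r^ (suc p)) (ur^ q)) (cong₂ _+_ (#u-r^ (suc p)) (#u-ur^ q))))) ⟩
  x + (suc p + q)
    ≡⟨ normalise x p q ⟩
  suc (x + p) + q ∎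
  where
  open ≡-Reasoning
  normalise : ∀ x p q → x + (suc p + q) ≡ suc (x + p) + q
  normalise = solve-∀

ballot-leastWordLow : ∀ x p q → Ballot 0 0 (leastWordLow x p q)
ballot-leastWordLow x p q =
  ballot-ur^-++ 0 0 x _ z≤n (ballot-u^-++ (x + 0) (x + 0) (suc p) _
    (ballot-r^-++ (suc p + (x + 0)) (x + 0) (suc p) _ ≤-refl (ballot-ur^ (suc p + (x + 0)) (suc p + (x + 0)) q ≤-refl)))

leastWordLow-InDB : ∀ {n} x p q → n ≡ suc (x + p) + q → InDB n (leastWordLow x p q)
leastWordLow-InDB x p q refl =
  ballot⇒InDB (suc (x + p) + q) (leastWordLow x p q) (length-leastWordLow x p q) (ballot-leastWordLow x p q)

endsWith-leastWordLow : ∀ x p q → EndsWith r (leastWordLow x p q)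
endsWith-leastWordLow x p q = endsWith-++ r (ur^ x) u _ (endsWith-++ r (u ∷ u^ p) r _ (ends q))
  where
  ends : ∀ q → EndsWith r (r ∷ (r^ p ++ ur^ q))
  ends zero    = subst (λ w → EndsWith r (r ∷ w)) (sym (++-identityʳ (r^ p))) (endsWith-replicate r p)
  ends (suc q) = endsWith-++ r (r ∷ r^ p) u (r ∷ ur^ q) (endsWith-ur^ q)

height-leastWordLow : ∀ x p q
  → height (leastWordLow x p q) ≡ staircase 0 x ++ replicate (suc p) (suc (x + p)) ++ staircase (suc (x + p)) q
height-leastWordLow x p q =
  trans (cong₂ _++_ rHeights≡ (lastEntry-endsWith-r _ (leastWordLow x p q) (endsWith-leastWordLow x p q)))
        (++-identityʳ _)
  where
  b : ℕ
  b = suc p + (x + 0)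
  b≡ : b ≡ suc (x + p)
  b≡ = cong suc (trans (cong (p +_) (+-identityʳ x)) (+-comm p x))
  rHeights≡ : rHeights 0 (leastWordLow x p q)
            ≡ staircase 0 x ++ replicate (suc p) (suc (x + p)) ++ staircase (suc (x + p)) q
  rHeights≡ = trans (rHeights-ur^-++ 0 x _) (cong (staircase 0 x ++_) (trans (rHeights-u^-++ (x + 0) (suc p) _)
    (trans (rHeights-r^-++ b (suc p) (ur^ q)) (trans (cong (replicate (suc p) b ++_) (rHeights-ur^ b q))
      (cong (λ b' → replicate (suc p) b' ++ staircase b' q) b≡)))))

-- Only the copies of x + p + 1 can pass a valid test: a staircase entry equals its test index
-- a' < b', and an index a' beyond the word has a' > n, so a' + b' > 2n + 1.
tail-bound-low : ∀ x p q j b' → suc (x + j) < b' → suc (x + j) + b' ≤ suc ((suc (x + p) + q) + (suc (x + p) + q))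
  → EntryGe j b' (replicate (suc p) (suc (x + p)) ++ staircase (suc (x + p)) q) → b' ≤ suc (x + p)
tail-bound-low x p q j b' a'<b' fits ge with j <? suc p
... | yes j≤p = EntryGe-replicate-++⁻ (suc p) _ _ j b' j≤p ge
... | no  j≰p with m≤n⇒∃[o]m+o≡n (≮⇒≥ j≰p)
...   | j' , refl with j' <? q
...     | yes j'<q = ⊥-elim (<-irrefl refl (≤-trans (subst (λ i → suc i < b') (shift x p j') a'<b')
          (subst (b' ≤_) (entry-staircase b q j' j'<q) (ge-tail (subst (j' <_) (sym (length-staircase b q)) j'<q)))))
  where
  b : ℕ
  b = suc (x + p)
  ge-tail : EntryGe j' b' (staircase b q)
  ge-tail = EntryGe-++ʳ⁻ (replicate (suc p) b) (staircase b q) j' b'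
    (subst (λ l → EntryGe (l + j') b' (replicate (suc p) b ++ staircase b q)) (sym (length-replicate (suc p))) ge)
  shift : ∀ x p j' → x + (suc p + j') ≡ suc (x + p) + j'
  shift = solve-∀
...     | no  j'≮q = ⊥-elim (m+1+n≰m (suc (n + n)) (≤-trans (≤-reflexive (normalise n))
          (≤-trans (+-mono-≤ n<a' (≤-trans (s≤s n<a') a'<b')) fits)))
  where
  n : ℕ
  n = suc (x + p) + q
  shift : ∀ x p j' → x + (suc p + j') ≡ suc (x + p) + j'
  shift = solve-∀
  n<a' : suc n ≤ suc (x + (suc p + j'))
  n<a' = s≤s (subst (n ≤_) (sym (trans (shift x p j') (trans (cong (suc (x + p) +_) (sym (m+[n∸m]≡n (≮⇒≥ j'≮q))))
                                   (sym (+-assoc (suc (x + p)) q _))))) (m≤m+n n _))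
  normalise : ∀ n → suc (n + n) + 2 ≡ suc n + suc (suc n)
  normalise = solve-∀

leastWordLow-passes : ∀ x p q → EntryGe x (suc (x + p)) (height (leastWordLow x p q))
leastWordLow-passes x p q = subst (EntryGe x (suc (x + p))) (sym (height-leastWordLow x p q))
  (EntryGe-staircase-++ x _ _ (λ _ → ≤-refl))

leastWordLow-passes⁻ : ∀ {n} x p q → n ≡ suc (x + p) + q → ∀ a' b' → InTB n (a' , b')
  → EntryGe (pred a') b' (height (leastWordLow x p q)) → suc x ≤ a' × b' ≤ suc (x + p)
leastWordLow-passes⁻ {n} x p q refl a' b' T@(1≤a' , a'<b' , _) ge =
  EntryGe-staircase-++⁻ (suc (n + n)) x _ (suc (x + p)) (tail-bound-low x p q) a' b' 1≤a' a'<b' (inTB⇒≤ n T)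
    (subst (EntryGe (pred a') b') (height-leastWordLow x p q) ge)

-- The least word passing test (x + 1, x + p + 1) when n < x + p + 1, with
-- x + 1 + (x + p + 1) + c = 2n + 1: heights 1, …, x, then c copies of x + p + 1 (and a
-- final x + p + 1 if c = 0).
leastWordHigh : ℕ → ℕ → ℕ → Word
leastWordHigh x p c = ur^ x ++ u^ (suc p) ++ r^ c

lastIfEmpty : ℕ → ℕ → List ℕ
lastIfEmpty b zero    = b ∷ []
lastIfEmpty b (suc _) = []

#u-leastWordHigh : ∀ x p c → #u (leastWordHigh x p c) ≡ suc (x + p)
#u-leastWordHigh x p c = trans (#u-++ (ur^ x) _)
  (trans (cong₂ _+_ (#u-ur^ x) (trans (#u-++ (u^ (suc p)) (r^ c)) (cong₂ _+_ (#u-u^ (suc p)) (#u-r^ c))))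
         (normalise x p))
  where
  normalise : ∀ x p → x + (suc p + 0) ≡ suc (x + p)
  normalise = solve-∀

height-leastWordHigh : ∀ x p c
  → height (leastWordHigh x p c) ≡ staircase 0 x ++ replicate c (suc (x + p)) ++ lastIfEmpty (suc (x + p)) c
height-leastWordHigh x p c = trans (cong₂ _++_ rHeights≡ (lastEntry≡ c)) (++-assoc (staircase 0 x) _ _)
  where
  b : ℕ
  b = suc p + (x + 0)
  b≡ : b ≡ suc (x + p)
  b≡ = cong suc (trans (cong (p +_) (+-identityʳ x)) (+-comm p x))
  rHeights≡ : rHeights 0 (leastWordHigh x p c) ≡ staircase 0 x ++ replicate c (suc (x + p))
  rHeights≡ = trans (rHeights-ur^-++ 0 x _) (cong (staircase 0 x ++_) (trans (rHeights-u^-++ (x + 0) (suc p) _)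
    (trans (rHeights-r^ b c) (cong (replicate c) b≡))))
  lastEntry≡ : ∀ c → lastEntry (#u (leastWordHigh x p c)) (leastWordHigh x p c) ≡ lastIfEmpty (suc (x + p)) c
  lastEntry≡ zero    = trans (lastEntry-endsWith-u _ (leastWordHigh x p 0)
    (endsWith-++ u (ur^ x) u _
      (subst (λ w → EndsWith u (u ∷ w)) (sym (++-identityʳ (u^ p))) (endsWith-replicate u p))))
    (cong (_∷ []) (#u-leastWordHigh x p 0))
  lastEntry≡ (suc c) = lastEntry-endsWith-r _ (leastWordHigh x p (suc c))
    (endsWith-++ r (ur^ x) u _ (endsWith-++ r (u ∷ u^ p) r _ (endsWith-replicate r c)))

leastWordHigh-InDB : ∀ {n} x p c → suc (n + n) ≡ suc x + suc (x + p) + c → n < suc (x + p)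
                   → InDB n (leastWordHigh x p c)
leastWordHigh-InDB {n} x p c 2n+1≡ n<b = ballot⇒InDB n _ len ballot
  where
  b : ℕ
  b = suc (x + p)
  normalise₁ : ∀ x p c → x + x + (suc p + c) ≡ x + suc (x + p) + c
  normalise₁ = solve-∀
  len : length (leastWordHigh x p c) ≡ 2 * n
  len = trans (length-++ (ur^ x)) (trans (cong₂ _+_ (length-ur^ x)
          (trans (length-++ (u^ (suc p))) (cong₂ _+_ (length-replicate (suc p)) (length-replicate c))))
        (trans (normalise₁ x p c) (trans (cong pred (sym 2n+1≡)) (sym (2n≡n+n n)))))
  normalise₂ : ∀ n → suc n + suc n ≡ suc (suc (n + n))
  normalise₂ = solve-∀
  normalise₃ : ∀ x c b → suc (suc x + b + c) ≡ suc (suc x + c) + b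
  normalise₃ = solve-∀
  -- b > n forces c < p: the r's never overtake the u's.
  c<p : c < p
  c<p = +-cancelˡ-≤ x _ _ (subst (_≤ x + p) (sym (+-suc x c)) (≤-pred (+-cancelʳ-≤ b _ _
          (subst (_≤ b + b) (trans (normalise₂ n) (trans (cong suc 2n+1≡) (normalise₃ x c b)))
                 (+-mono-≤ n<b n<b)))))
  ballot : Ballot 0 0 (leastWordHigh x p c)
  ballot = ballot-ur^-++ 0 0 x _ z≤n (ballot-u^-++ (x + 0) (x + 0) (suc p) _
    (ballot-r^ (suc p + (x + 0)) (x + 0) c (+-monoˡ-≤ (x + 0) (≤-trans (n≤1+n c) (s≤s (<⇒≤ c<p))))))

tail-bound-high : ∀ M x p c last → M ≡ suc x + suc (x + p) + c
  → ∀ j b' → suc (x + j) < b' → suc (x + j) + b' ≤ M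
  → EntryGe j b' (replicate c (suc (x + p)) ++ last) → b' ≤ suc (x + p)
tail-bound-high M x p c last M≡ j b' _ fits ge with j <? c
... | yes j<c = EntryGe-replicate-++⁻ c _ last j b' j<c ge
... | no  j≮c = +-cancelˡ-≤ (suc (x + c)) b' _
  (≤-trans (+-monoˡ-≤ b' (s≤s (+-monoʳ-≤ x (≮⇒≥ j≮c))))
           (≤-trans fits (≤-reflexive (trans M≡ (normalise x p c)))))
  where
  normalise : ∀ x p c → suc x + suc (x + p) + c ≡ suc (x + c) + suc (x + p)
  normalise = solve-∀

leastWordHigh-passes : ∀ x p c → EntryGe x (suc (x + p)) (height (leastWordHigh x p c))
leastWordHigh-passes x p c = subst (EntryGe x (suc (x + p))) (sym (height-leastWordHigh x p c))
  (EntryGe-staircase-++ x _ _ (first c))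
  where
  first : ∀ c → EntryGe 0 (suc (x + p)) (replicate c (suc (x + p)) ++ lastIfEmpty (suc (x + p)) c)
  first zero    _ = ≤-refl
  first (suc c) _ = ≤-refl

leastWordHigh-passes⁻ : ∀ {n} x p c → suc (n + n) ≡ suc x + suc (x + p) + c → ∀ a' b' → InTB n (a' , b')
  → EntryGe (pred a') b' (height (leastWordHigh x p c)) → suc x ≤ a' × b' ≤ suc (x + p)
leastWordHigh-passes⁻ {n} x p c 2n+1≡ a' b' T@(1≤a' , a'<b' , _) ge =
  EntryGe-staircase-++⁻ (suc (n + n)) x _ (suc (x + p)) (tail-bound-high (suc (n + n)) x p c _ 2n+1≡)
    a' b' 1≤a' a'<b' (inTB⇒≤ n T) (subst (EntryGe (pred a') b') (height-leastWordHigh x p c) ge)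

-- A sorted h failing test (a, b) has its first a entries below b; so every test passed by h
-- is passed by a sequence starting with a copies of b - 1, provided the rest passes the tests beyond a.
EntryGe-replicate-++ : ∀ (Test : ℕ × ℕ → Set) a b rest h
  → (∀ i j → i ≤ j → j < length h → entry h i ≤ entry h j)
  → (∀ j b' → Test (suc (a + j) , b') → EntryGe j b' rest)
  → ¬ EntryGe (pred a) b h
  → ∀ a' b' → 1 ≤ a' → Test (a' , b') → EntryGe (pred a') b' h
  → EntryGe (pred a') b' (replicate a (pred b) ++ rest)
EntryGe-replicate-++ Test a b rest h sorted rest-passes fails (suc i) b' _ test ge
  with i <? a | ¬EntryGe (pred a) b h fails
... | yes i<a | a-1<k , hₐ<b =
  EntryGe-++ˡ⁺ (replicate a (pred b)) rest i b' (subst (i <_) (sym (length-replicate a)) i<a)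
  (subst (b' ≤_) (sym (entry-replicate a (pred b) i i<a))
    (≤-trans (≤-trans (ge (≤-<-trans i≤a-1 a-1<k)) (sorted i (pred a) i≤a-1 a-1<k)) (<⇒≤pred hₐ<b)))
  where
  i≤a-1 : i ≤ pred a
  i≤a-1 = <⇒≤pred i<a
... | no  i≮a | _ with m≤n⇒∃[o]m+o≡n (≮⇒≥ i≮a)
...   | j , refl = subst (λ l → EntryGe (l + j) b' (replicate a (pred b) ++ rest)) (length-replicate a)
                     (EntryGe-++ʳ⁺ (replicate a (pred b)) rest j b' (rest-passes j b' test))

¬EntryGe-replicate-++ : ∀ a b rest → 1 ≤ a → 1 ≤ b → ¬ EntryGe (pred a) b (replicate a (pred b) ++ rest)
¬EntryGe-replicate-++ (suc a) (suc b) rest _ _ ge = 1+n≰n (EntryGe-replicate-++⁻ (suc a) b rest a (suc b) (n<1+n a) ge)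

-- The greatest word of D_n^B failing test (a, b' + 1) is u^b' r^a u^c, where a + (b' + 1) + c = 2n + 1.
failingWordB : ℕ → ℕ → ℕ → Word
failingWordB b' a c = u^ b' ++ r^ a ++ u^ c

lastIfNonempty : ℕ → ℕ → List ℕ
lastIfNonempty v zero    = []
lastIfNonempty v (suc _) = v ∷ []

height-failingWordB : ∀ b' a c → 1 ≤ a → height (failingWordB b' a c) ≡ replicate a b' ++ lastIfNonempty (b' + c) c
height-failingWordB b' (suc a) c _ = cong₂ _++_ rHeights≡ (lastEntry≡ c)
  where
  rHeights≡ : rHeights 0 (failingWordB b' (suc a) c) ≡ replicate (suc a) b'
  rHeights≡ = trans (rHeights-u^-++ 0 b' _) (trans (rHeights-r^-++ (b' + 0) (suc a) (u^ c))
    (trans (cong (replicate (suc a) (b' + 0) ++_) (rHeights-u^ (b' + 0) c))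
      (trans (++-identityʳ _) (cong (replicate (suc a)) (+-identityʳ b')))))
  #u≡ : ∀ c → #u (failingWordB b' (suc a) c) ≡ b' + c
  #u≡ c = trans (#u-++ (u^ b') _)
    (cong₂ _+_ (#u-u^ b') (trans (#u-++ (r^ (suc a)) (u^ c)) (cong₂ _+_ (#u-r^ (suc a)) (#u-u^ c))))
  lastEntry≡ : ∀ c → lastEntry (#u (failingWordB b' (suc a) c)) (failingWordB b' (suc a) c)
                   ≡ lastIfNonempty (b' + c) c
  lastEntry≡ zero    = lastEntry-endsWith-r _ (failingWordB b' (suc a) 0)
    (endsWith-++ r (u^ b') r _ (subst (λ w → EndsWith r (r ∷ w)) (sym (++-identityʳ (r^ a))) (endsWith-replicate r a)))
  lastEntry≡ (suc c) = trans (lastEntry-endsWith-u _ (failingWordB b' (suc a) (suc c))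
    (endsWith-++ u (u^ b') r _ (endsWith-++ u (r ∷ r^ a) u _ (endsWith-replicate u c))))
    (cong (_∷ []) (#u≡ (suc c)))

length-failingWordB : ∀ b' a c → length (failingWordB b' a c) ≡ b' + (a + c)
length-failingWordB b' a c = trans (length-++ (u^ b'))
  (cong₂ _+_ (length-replicate b') (trans (length-++ (r^ a)) (cong₂ _+_ (length-replicate a) (length-replicate c))))

ballot-failingWordB : ∀ b' a c → a ≤ b' → Ballot 0 0 (failingWordB b' a c)
ballot-failingWordB b' a c a≤b' = ballot-u^-++ 0 0 b' _
  (ballot-r^-++ (b' + 0) 0 a _ (subst₂ _≤_ (sym (+-identityʳ a)) (sym (+-identityʳ b')) a≤b')
    (ballot-u^ (b' + 0) (a + 0) c))

-- The greatest word of D_n^A failing test (a, b' + 1) is u^b' r^a u^(q + 1) r^d, where b' + 1 + q = a + d = n.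
failingWordA : ℕ → ℕ → ℕ → ℕ → Word
failingWordA b' a q d = u^ b' ++ r^ a ++ u^ (suc q) ++ r^ d

height-failingWordA : ∀ b' a q d → 1 ≤ d
  → height (failingWordA b' a q d) ≡ replicate a b' ++ replicate d (b' + suc q)
height-failingWordA b' a q (suc d) _ =
  trans (cong₂ _++_ rHeights≡ (lastEntry-endsWith-r _ (failingWordA b' a q (suc d)) ends)) (++-identityʳ _)
  where
  ends : EndsWith r (failingWordA b' a q (suc d))
  ends = endsWith-++ʳ r (u^ b') _ (endsWith-++ʳ r (r^ a) _ (endsWith-++ r (u ∷ u^ q) r _ (endsWith-replicate r d)))
  normalise : ∀ b' q → suc q + (b' + 0) ≡ b' + suc q
  normalise = solve-∀
  rHeights≡ : rHeights 0 (failingWordA b' a q (suc d)) ≡ replicate a b' ++ replicate (suc d) (b' + suc q)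
  rHeights≡ = trans (rHeights-u^-++ 0 b' _) (trans (rHeights-r^-++ (b' + 0) a _)
    (trans (cong (replicate a (b' + 0) ++_)
             (trans (rHeights-u^-++ (b' + 0) (suc q) (r^ (suc d))) (rHeights-r^ (suc q + (b' + 0)) (suc d))))
      (cong₂ (λ y z → replicate a y ++ replicate (suc d) z) (+-identityʳ b') (normalise b' q))))

#u-failingWordA : ∀ b' a q d → #u (failingWordA b' a q d) ≡ b' + suc q
#u-failingWordA b' a q d = trans (#u-++ (u^ b') _) (cong₂ _+_ (#u-u^ b') (trans (#u-++ (r^ a) _) (cong₂ _+_ (#u-r^ a)
  (trans (#u-++ (u^ (suc q)) (r^ d)) (trans (cong₂ _+_ (#u-u^ (suc q)) (#u-r^ d)) (+-identityʳ (suc q)))))))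

length-failingWordA : ∀ b' a q d → length (failingWordA b' a q d) ≡ b' + (a + (suc q + d))
length-failingWordA b' a q d = trans (length-++ (u^ b')) (cong₂ _+_ (length-replicate b') (trans (length-++ (r^ a))
  (cong₂ _+_ (length-replicate a)
    (trans (length-++ (u^ (suc q))) (cong₂ _+_ (length-replicate (suc q)) (length-replicate d))))))

ballot-failingWordA : ∀ b' a q d → a ≤ b' → d + a ≤ suc q + b' → Ballot 0 0 (failingWordA b' a q d)
ballot-failingWordA b' a q d a≤b' d+a≤ = ballot-u^-++ 0 0 b' _
  (ballot-r^-++ (b' + 0) 0 a _ (subst₂ _≤_ (sym (+-identityʳ a)) (sym (+-identityʳ b')) a≤b')
    (ballot-u^-++ (b' + 0) (a + 0) (suc q) _ (ballot-r^ (suc q + (b' + 0)) (a + 0) d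
      (subst₂ _≤_ (cong (d +_) (sym (+-identityʳ a))) (cong (suc q +_) (sym (+-identityʳ b'))) d+a≤))))

tests : ℕ → List (ℕ × ℕ)
tests N = cartesianProduct (upTo N) (upTo N)

∈-tests : ∀ {N a b} → a < N → b < N → (a , b) ∈ tests N
∈-tests a<N b<N = ∈-cartesianProduct⁺ (applyUpTo⁺ id refl a<N) (applyUpTo⁺ id refl b<N)

InTA? : ∀ n t → Dec (InTA n t)
InTA? n (a , b) = (1 ≤? a) ×-dec ((a <? b) ×-dec (b ≤? n))

InTB? : ∀ n t → Dec (InTB n t)
InTB? n (a , b) = (1 ≤? a) ×-dec ((a <? b) ×-dec (a + b ≤? 2 * n + 1))

≤T-antisym : ∀ {s t} → s ≤T t → t ≤T s → s ≡ t
≤T-antisym {a , b} {a' , b'} (a'≤a , b≤b') (a≤a' , b'≤b) =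
  cong₂ _,_ (≤-antisym a≤a' a'≤a) (≤-antisym b≤b' b'≤b)

Passes-mono : ∀ t {w w'} → w ≤W w' → Passes t w → Passes t w'
Passes-mono (a , b) w≤w' = EntryGe-mono w≤w' (pred a) b

record LeastPassing (n : ℕ) (t : ℕ × ℕ) (w : Word) : Set where
  field
    inDB    : InDB n w
    passes  : Passes t w
    passes⁻ : ∀ {s} → InTB n s → Passes s w → s ≤T t

record GreatestFailing (S : Word → Set) (t : ℕ × ℕ) (w : Word) : Set where
  field
    inS      : S w
    fails    : ¬ Passes t w
    greatest : ∀ {w'} → S w' → ¬ Passes t w' → w' ≤W w

module _ (n : ℕ) (0<n : 0 < n) where

  Passes-antitone : ∀ {s t w} → InDB n w → s ≤T t → Passes t w → Passes s w
  Passes-antitone {a' , b'} {a , b} {w} w∈ (a≤a' , b'≤b) passes a'-1<k =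
    ≤-trans b'≤b (≤-trans (passes (≤-<-trans (pred-mono-≤ a≤a') a'-1<k))
                          (HeightShape.sorted (height-shape n w w∈ 0<n) (pred a) (pred a') (pred-mono-≤ a≤a') a'-1<k))

  ≤W-antisym : ∀ {w w'} → InDB n w → InDB n w' → w ≤W w' → w' ≤W w → w ≡ w'
  ≤W-antisym (len , _) (len' , _) w≤w' w'≤w = height-injective (trans len (sym len')) (≤D-antisym w≤w' w'≤w)

  ≤W-byTestsB : ∀ {w w'} → InDB n w → InDB n w' → (∀ t → InTB n t → Passes t w → Passes t w') → w ≤W w'
  ≤W-byTestsB {w} {w'} w∈ w'∈ transfer =
    tests⇒≤D (height-shape n w w∈ 0<n) (height-shape n w' w'∈ 0<n) (λ a b → transfer (a , b))

  least : ℕ × ℕ → Word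
  least (a , b) with b ≤? n
  ... | yes _ = leastWordLow  (pred a) (b ∸ a) (n ∸ b)
  ... | no  _ = leastWordHigh (pred a) (b ∸ a) (suc (n + n) ∸ (a + b))

  least-leastPassing : ∀ {t} → InTB n t → LeastPassing n t (least t)
  least-leastPassing {suc x , b} T@(_ , x<b , _) with m≤n⇒∃[o]m+o≡n (<⇒≤ x<b)
  ... | p , refl with suc (x + p) ≤? n
  ...   | yes b≤n rewrite m+n∸m≡n x p = record
    { inDB    = leastWordLow-InDB x p q n≡
    ; passes  = leastWordLow-passes x p q
    ; passes⁻ = λ {(a' , b')} T' → leastWordLow-passes⁻ x p q n≡ a' b' T'
    }
    where
    q : ℕ
    q = n ∸ suc (x + p)
    n≡ : n ≡ suc (x + p) + q
    n≡ = sym (m+[n∸m]≡n b≤n)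
  ...   | no  b≰n rewrite m+n∸m≡n x p = record
    { inDB    = leastWordHigh-InDB x p c 2n+1≡ (≰⇒> b≰n)
    ; passes  = leastWordHigh-passes x p c
    ; passes⁻ = λ {(a' , b')} T' → leastWordHigh-passes⁻ {n} x p c 2n+1≡ a' b' T'
    }
    where
    c : ℕ
    c = suc (n + n) ∸ (suc x + suc (x + p))
    2n+1≡ : suc (n + n) ≡ suc x + suc (x + p) + c
    2n+1≡ = sym (m+[n∸m]≡n (inTB⇒≤ n T))

  failingB : ℕ × ℕ → Word
  failingB (a , b) = failingWordB (pred b) a (suc (n + n) ∸ (a + b))

  module _ {a b' : ℕ} (T : InTB n (a , suc b')) where

    private
      c : ℕ
      c = suc (n + n) ∸ (a + suc b')
      2n+1≡ : suc (n + n) ≡ a + suc b' + c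
      2n+1≡ = sym (m+[n∸m]≡n (inTB⇒≤ n T))
      height-failingB : height (failingB (a , suc b')) ≡ replicate a b' ++ lastIfNonempty (b' + c) c
      height-failingB = height-failingWordB b' a c (proj₁ T)

    failingB-InDB : InDB n (failingB (a , suc b'))
    failingB-InDB = ballot⇒InDB n _ len (ballot-failingWordB b' a c (≤-pred (proj₁ (proj₂ T))))
      where
      normalise : ∀ a b' c → a + suc b' + c ≡ suc (b' + (a + c))
      normalise = solve-∀
      len : length (failingWordB b' a c) ≡ 2 * n
      len = trans (length-failingWordB b' a c)
        (trans (suc-injective (trans (sym (normalise a b' c)) (sym 2n+1≡))) (sym (2n≡n+n n)))

    failingB-fails : ¬ Passes (a , suc b') (failingB (a , suc b'))
    failingB-fails passes = ¬EntryGe-replicate-++ a (suc b') _ (proj₁ T) (s≤s z≤n)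
      (subst (EntryGe (pred a) (suc b')) height-failingB passes)

    -- The final entry b' + c of failingB is tested only by (a + 1, b''), and b'' ≤ b' + c
    -- because a + 1 + b'' ≤ 2n + 1 = a + b' + 1 + c.
    failingB-greatest : ∀ {w} → InDB n w → ¬ Passes (a , suc b') w → w ≤W failingB (a , suc b')
    failingB-greatest {w} w∈ fails = ≤W-byTestsB w∈ failingB-InDB λ (a' , b'') T' passes →
      subst (EntryGe (pred a') b'') (sym height-failingB)
        (EntryGe-replicate-++ (InTB n) a (suc b') _ (height w) (HeightShape.sorted (height-shape n w w∈ 0<n))
          (tail-passes c refl) fails a' b'' (proj₁ T') T' passes)
      where
      normalise₁ : ∀ a b → suc (a + 0) + b ≡ suc (a + b)
      normalise₁ = solve-∀
      normalise₂ : ∀ a b' c → a + suc b' + suc c ≡ suc (a + (b' + suc c))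
      normalise₂ = solve-∀
      tail-passes : ∀ c' → c' ≡ c → ∀ j b'' → InTB n (suc (a + j) , b'')
                  → EntryGe j b'' (lastIfNonempty (b' + c') c')
      tail-passes zero     _    j       b'' _  ()
      tail-passes (suc c') c'≡c zero    b'' T' _ = +-cancelˡ-≤ a _ _ (≤-pred (subst₂ _≤_ (normalise₁ a b'')
        (trans 2n+1≡ (trans (cong (a + suc b' +_) (sym c'≡c)) (normalise₂ a b' c'))) (inTB⇒≤ n T')))
      tail-passes (suc c') _    (suc j) b'' _  (s≤s ())

  failingB-greatestFailing : ∀ {t} → InTB n t → GreatestFailing (InDB n) t (failingB t)
  failingB-greatestFailing {a , suc b'} T = record
    { inS = failingB-InDB T ; fails = failingB-fails T ; greatest = failingB-greatest T }

  TB⊆tests : ∀ {t} → InTB n t → t ∈ tests (suc (2 * n + 1))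
  TB⊆tests {a , b} (_ , _ , a+b≤) = ∈-tests (s≤s (m+n≤o⇒m≤o a a+b≤)) (s≤s (m+n≤o⇒n≤o a a+b≤))

  joinIrreducibles≅TB : SubposetIso (JoinIrreducibleIn (InDB n) _≤W_) _≤W_ (InTB n) _≤T_
  joinIrreducibles≅TB = JoinIrreduciblesByTests.joinIrreducibles≅tests
    (InDB n) _≤W_ (InTB n) _≤T_ Passes
    ≤T-antisym ≤W-antisym ≤W-byTestsB Passes-mono Passes-antitone
    (InTB? n) Passes? (tests (suc (2 * n + 1))) TB⊆tests
    least (λ T → inDB (least-leastPassing T)) (λ T → passes (least-leastPassing T))
    (λ T' T → passes⁻ (least-leastPassing T) T')
    failingB (λ T → inS (failingB-greatestFailing T)) (λ T → fails (failingB-greatestFailing T))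
    (λ T → greatest (failingB-greatestFailing T))
    where
    open LeastPassing
    open GreatestFailing

module _ (n : ℕ) (0<n : 0 < n) where

  private
    InDA⇒InDB : ∀ {w} → InDA n w → InDB n w
    InDA⇒InDB = proj₁

  TA⊆TB : ∀ {t} → InTA n t → InTB n t
  TA⊆TB (1≤a , a<b , b≤n) = inTB n 1≤a a<b (≤-trans (+-mono-≤ (<⇒≤ (≤-trans a<b b≤n)) b≤n) (n≤1+n _))

  heightShapeA : ∀ {w} → InDA n w → HeightShape n n (height w)
  heightShapeA {w} (w∈ , #u≡n) = subst (λ U → HeightShape n U (height w)) #u≡n (height-shape n w w∈ 0<n)

  length-heightA : ∀ {h} → HeightShape n n h → length h ≡ n
  length-heightA v with HeightShape.shape v
  ... | inj₁ (k≡R , _)      = trans k≡R (+-cancelˡ-≡ n _ _ (HeightShape.U+R≡n+n v))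
  ... | inj₂ (_ , R<n , _) =
    ⊥-elim (1+n≰n (subst (λ R → suc R ≤ n) (+-cancelˡ-≡ n _ _ (HeightShape.U+R≡n+n v)) R<n))

  -- Tests (a, b) of T_n^B with b > n are failed by every word of D_n^A, whose n entries are at most n.
  ≤W-byTestsA : ∀ {w w'} → InDA n w → InDA n w' → (∀ t → InTA n t → Passes t w → Passes t w') → w ≤W w'
  ≤W-byTestsA {w} {w'} w∈ w'∈ transfer = tests⇒≤D (heightShapeA w∈) (heightShapeA w'∈) transferB
    where
    transferB : TestsTransfer n (height w) (height w')
    transferB a b T@(1≤a , a<b , _) passes with b ≤? n
    ... | yes b≤n = transfer (a , b) (1≤a , a<b , b≤n) passes
    ... | no  b≰n = ⊥-elim (1+n≰n (≤-trans (≰⇒> b≰n)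
                      (≤-trans (passes a-1<k) (HeightShape.entry≤U v (pred a) a-1<k))))
      where
      v : HeightShape n n (height w)
      v = heightShapeA w∈
      a≤n : a ≤ n
      a≤n = +-cancelʳ-≤ (suc n) a n (≤-trans (+-monoʳ-≤ a (≰⇒> b≰n))
                                              (subst (a + b ≤_) (sym (+-suc n n)) (inTB⇒≤ n T)))
      a-1<k : pred a < length (height w)
      a-1<k = subst (pred a <_) (sym (length-heightA v)) (≤-trans (pred< 1≤a) a≤n)
        where
        pred< : ∀ {a} → 1 ≤ a → pred a < a
        pred< (s≤s _) = ≤-refl

  least-InDA : ∀ {t} → InTA n t → InDA n (least n 0<n t)
  least-InDA {t} T = LeastPassing.inDB (least-leastPassing n 0<n (TA⊆TB T)) , #u≡n t T
    where
    #u≡n : ∀ t → InTA n t → #u (least n 0<n t) ≡ n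
    #u≡n (suc x , b) (_ , x<b , b≤n) with m≤n⇒∃[o]m+o≡n (<⇒≤ x<b)
    ... | p , refl with suc (x + p) ≤? n
    ...   | yes b≤n' rewrite m+n∸m≡n x p = trans (#u-leastWordLow x p (n ∸ suc (x + p))) (m+[n∸m]≡n b≤n')
    ...   | no  b≰n = ⊥-elim (b≰n b≤n)

  failingA : ℕ × ℕ → Word
  failingA (a , b) = failingWordA (pred b) a (n ∸ b) (n ∸ a)

  module _ {a b' : ℕ} (T : InTA n (a , suc b')) where

    private
      a≤b' : a ≤ b'
      a≤b' = ≤-pred (proj₁ (proj₂ T))
      b≤n : suc b' ≤ n
      b≤n = proj₂ (proj₂ T)
      q d : ℕ
      q = n ∸ suc b'
      d = n ∸ a
      b+q≡n : suc b' + q ≡ n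
      b+q≡n = m+[n∸m]≡n b≤n
      a+d≡n : a + d ≡ n
      a+d≡n = m+[n∸m]≡n (≤-trans (m≤n⇒m≤1+n a≤b') b≤n)
      b'+1+q≡n : b' + suc q ≡ n
      b'+1+q≡n = trans (+-suc b' q) b+q≡n
      1≤d : 1 ≤ d
      1≤d with d | a+d≡n
      ... | zero  | a+0≡n = ⊥-elim (1+n≰n (≤-trans (s≤s a≤b')
                              (≤-trans b≤n (≤-reflexive (trans (sym a+0≡n) (+-identityʳ a))))))
      ... | suc _ | _     = s≤s z≤n
      height-failingA : height (failingA (a , suc b')) ≡ replicate a b' ++ replicate d n
      height-failingA = trans (height-failingWordA b' a q d 1≤d)
                              (cong (λ h → replicate a b' ++ replicate d h) b'+1+q≡n)

    failingA-InDA : InDA n (failingA (a , suc b'))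
    failingA-InDA = ballot⇒InDB n _ len (ballot-failingWordA b' a q d a≤b' d+a≤)
                  , trans (#u-failingWordA b' a q d) b'+1+q≡n
      where
      normalise : ∀ b' a q d → b' + (a + (suc q + d)) ≡ (suc b' + q) + (a + d)
      normalise = solve-∀
      len : length (failingWordA b' a q d) ≡ 2 * n
      len = trans (length-failingWordA b' a q d)
                  (trans (normalise b' a q d) (trans (cong₂ _+_ b+q≡n a+d≡n) (sym (2n≡n+n n))))
      d+a≤ : d + a ≤ suc q + b'
      d+a≤ = ≤-reflexive (trans (+-comm d a) (trans a+d≡n (trans (sym b+q≡n) (cong suc (+-comm b' q)))))

    failingA-fails : ¬ Passes (a , suc b') (failingA (a , suc b'))
    failingA-fails passes = ¬EntryGe-replicate-++ a (suc b') _ (proj₁ T) (s≤s z≤n)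
      (subst (EntryGe (pred a) (suc b')) height-failingA passes)

    failingA-greatest : ∀ {w} → InDA n w → ¬ Passes (a , suc b') w → w ≤W failingA (a , suc b')
    failingA-greatest {w} w∈ fails = ≤W-byTestsA w∈ failingA-InDA λ (a' , b'') T' passes →
      subst (EntryGe (pred a') b'') (sym height-failingA)
        (EntryGe-replicate-++ (InTA n) a (suc b') _ (height w) (HeightShape.sorted (heightShapeA w∈))
          tail-passes fails a' b'' (proj₁ T') T' passes)
      where
      tail-passes : ∀ j b'' → InTA n (suc (a + j) , b'') → EntryGe j b'' (replicate d n)
      tail-passes j b'' (_ , _ , b''≤n) j<d =
        subst (b'' ≤_) (sym (entry-replicate d n j (subst (j <_) (length-replicate d) j<d))) b''≤n

  failingA-greatestFailing : ∀ {t} → InTA n t → GreatestFailing (InDA n) t (failingA t)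
  failingA-greatestFailing {a , suc b'} T = record
    { inS = failingA-InDA T ; fails = failingA-fails T ; greatest = failingA-greatest T }

  joinIrreducibles≅TA : SubposetIso (JoinIrreducibleIn (InDA n) _≤W_) _≤W_ (InTA n) _≤T_
  joinIrreducibles≅TA = JoinIrreduciblesByTests.joinIrreducibles≅tests
    (InDA n) _≤W_ (InTA n) _≤T_ Passes
    ≤T-antisym (λ w∈ w'∈ → ≤W-antisym n 0<n (InDA⇒InDB w∈) (InDA⇒InDB w'∈)) ≤W-byTestsA Passes-mono
    (λ w∈ → Passes-antitone n 0<n (InDA⇒InDB w∈))
    (InTA? n) Passes? (tests (suc n)) TA⊆tests
    (least n 0<n) least-InDA (λ T → passes (least-leastPassing n 0<n (TA⊆TB T)))
    (λ T' T → passes⁻ (least-leastPassing n 0<n (TA⊆TB T)) (TA⊆TB T'))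
    failingA (λ T → inS (failingA-greatestFailing T)) (λ T → fails (failingA-greatestFailing T))
    (λ T → greatest (failingA-greatestFailing T))
    where
    open LeastPassing
    open GreatestFailing
    TA⊆tests : ∀ {t} → InTA n t → t ∈ tests (suc n)
    TA⊆tests (_ , a<b , b≤n) = ∈-tests (s≤s (≤-trans (<⇒≤ a<b) b≤n)) (s≤s b≤n)

lemma2p19 : (n : ℕ) → 0 < n →
    SubposetIso (JoinIrreducibleIn (InDA n) _≤W_) _≤W_ (InTA n) _≤T_
    × SubposetIso (JoinIrreducibleIn (InDB n) _≤W_) _≤W_ (InTB n) _≤T_
lemma2p19 n 0<n = joinIrreducibles≅TA n 0<n , joinIrreducibles≅TB n 0<n
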